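{- Let $f_{\mathrm{UFR}}(n,k)$ be the number of unit Fubini rankings with $n$ competitors having exactly $k$ lucky cars (with $f_{\mathrm{UFR}}(0,0)=1$ and $f_{\mathrm{UFR}}(0,k)=0$ for $k\ne0$). Then, as formal power series, \[\sum_{n\ge0}\sum_{k\ge0}f_{\mathrm{UFR}}(n,k)\,q^k\frac{x^n}{n!}=\frac{1}{1-q\left(x+\frac{x^2}{2}\right)}.\]
   Context: A unit Fubini ranking with $n$ competitors is a tuple $\alpha=(a_1,\ldots,a_n)\in\{1,\ldots,n\}^n$ with $a_i=1+|\{j:a_j<a_i\}|$ for every $i$ and in which each value appears at most twice. Lucky cars: cars $1,\ldots,n$ enter in order a one-way street with spots $1,\ldots,n$; car $i$ parks at spot $a_i$ if free, else at the first free spot after $a_i$; car $i$ is lucky if it parks at spot $a_i$. -}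

module Defs where

open import Data.Bool using (Bool; true; false; if_then_else_; _∧_)
open import Data.Nat as Nat using (ℕ; zero; suc; _+_; _∸_; _!; _≡ᵇ_; _<ᵇ_; _≤ᵇ_)
open import Data.Nat.Properties using (_!≢0)
open import Data.List using (List; []; _∷_; map; concatMap; filter; length; upTo; foldr)
open import Data.Maybe using (Maybe; just; nothing)
open import Data.Integer using (+_)
open import Data.Rational as ℚ using (ℚ; 0ℚ; 1ℚ; ½)
open import Relation.Nullary.Decidable using (does)
open import Data.Bool using (T?)
open import Relation.Binary.PropositionalEquality using (_≡_)

oneTo : ℕ → List ℕ
oneTo m = map suc (upTo m)

allTuples : ℕ → ℕ → List (List ℕ)
allTuples zero    m = [] ∷ []
allTuples (suc n) m = concatMap (λ a → map (a ∷_) (allTuples n m)) (oneTo m)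

countBy : (ℕ → Bool) → List ℕ → ℕ
countBy p α = length (filter (λ b → T? (p b)) α)

allB : (ℕ → Bool) → List ℕ → Bool
allB p []       = true
allB p (a ∷ α) = p a ∧ allB p α

isFubiniRanking : List ℕ → Bool
isFubiniRanking α = allB (λ a → a ≡ᵇ suc (countBy (λ b → b <ᵇ a) α)) α

atMostTwice : List ℕ → Bool
atMostTwice α = allB (λ a → countBy (λ b → b ≡ᵇ a) α ≤ᵇ 2) α

isUnitFubini : List ℕ → Bool
isUnitFubini α = isFubiniRanking α ∧ atMostTwice α

member : ℕ → List ℕ → Bool
member s []       = false
member s (t ∷ ts) = if s ≡ᵇ t then true else member s ts

firstFree : List ℕ → List ℕ → Maybe ℕ
firstFree occ []       = nothing
firstFree occ (s ∷ ss) = if member s occ then firstFree occ ss else just s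

parkSpot : ℕ → List ℕ → ℕ → Maybe ℕ
parkSpot n occ a = firstFree occ (filter (λ s → a Nat.≤? s) (oneTo n))

luckyAux : ℕ → List ℕ → List ℕ → ℕ
luckyAux n occ []      = 0
luckyAux n occ (a ∷ α) with parkSpot n occ a
... | nothing = luckyAux n occ α
... | just s  = (if s ≡ᵇ a then 1 else 0) + luckyAux n (s ∷ occ) α

luckyCars : ℕ → List ℕ → ℕ
luckyCars n α = luckyAux n [] α

fUFR : ℕ → ℕ → ℕ
fUFR n k = length (filter (λ α → T? (isUnitFubini α ∧ (luckyCars n α ≡ᵇ k)))
                          (allTuples n n))

-- Formal power series in q and x with rational coefficients:
-- S n k is the coefficient of q^k x^n.

Series : Set
Series = ℕ → ℕ → ℚ

sumTo : ℕ → (ℕ → ℚ) → ℚ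
sumTo n f = foldr ℚ._+_ 0ℚ (map f (upTo (suc n)))

_⊕_ : Series → Series → Series
(F ⊕ G) n k = F n k ℚ.+ G n k

_⊖_ : Series → Series → Series
(F ⊖ G) n k = F n k ℚ.- G n k

_⊛_ : Series → Series → Series
(F ⊛ G) n k = sumTo n (λ i → sumTo k (λ j → F i j ℚ.* G (n ∸ i) (k ∸ j)))

_·ₛ_ : ℚ → Series → Series
(c ·ₛ F) n k = c ℚ.* F n k

oneS : Series
oneS zero zero = 1ℚ
oneS _    _    = 0ℚ

xS : Series
xS 1 0 = 1ℚ
xS _ _ = 0ℚ

qS : Series
qS 0 1 = 1ℚ
qS _ _ = 0ℚ

ufrEGF : Series
ufrEGF n k = ((+ fUFR n k) ℚ./ (n !)) {{n !≢0}}

denominator : Series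
denominator = oneS ⊖ (qS ⊛ (xS ⊕ (½ ·ₛ (xS ⊛ xS))))

{-# OPTIONS --safe #-}
module Submission where

-- In a unit Fubini ranking every value v occurs once or twice and the next value is v + 1 or
-- v + 2 accordingly, so the cars with preference v park at v and, for a tie, at v + 1. Hence a
-- car is lucky exactly when its preference has not occurred before, and the lucky cars count the
-- distinct values. Deleting the largest value from a ranking of n + 2 competitors leaves a
-- ranking with one value fewer; the deleted value occupied one of the n + 2 positions or a pair
-- of them, so f(n + 2, k + 1) = (n + 2) f(n + 1, k) + C(n + 2, 2) f(n, k). Divided by (n + 2)!
-- this is the coefficient recurrence of 1 / (1 - q (x + x²/2)).

open import Defs
open import Algebra.Bundles using (CommutativeMonoid)
import Algebra.Properties.CommutativeSemigroup as CommSemigroupProperties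
open import Data.Bool using (Bool; true; false; if_then_else_; _∧_; _∨_; not; T; T?)
open import Data.Bool.Properties
  using (∧-conicalˡ; ∧-conicalʳ; ∧-zeroʳ; ∨-zeroʳ; ∧-commutativeMonoid; ⇔→≡)
open import Data.Empty using (⊥-elim)
import Data.Integer as ℤ
import Data.Integer.Properties as ℤ
import Data.Integer.Tactic.RingSolver as ℤ-Solver
open import Data.List using (List; []; _∷_; length; filter; map; _++_; concatMap; foldr; applyUpTo)
open import Data.List.Properties using (length-++; filter-++; map-cong; map-++; map-upTo)
open import Data.Maybe using (just)
open import Data.Nat as ℕ
  using (ℕ; zero; suc; _+_; _*_; _∸_; _≤_; _<_; z≤n; s≤s; _≡ᵇ_; _<ᵇ_; _≤ᵇ_; _≤?_; _⊔_; _!; NonZero)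
open import Data.Nat.Combinatorics using (_C_; k>n⇒nCk≡0; nC1≡n; nCk+nC[k+1]≡[n+1]C[k+1])
open import Data.Nat.ListAction using (sum)
open import Data.Nat.ListAction.Properties using (sum-++)
open import Data.Nat.Properties
open import Data.Nat.Tactic.RingSolver using (solve-∀)
open import Data.Product using (_×_; _,_; proj₁)
open import Data.Rational as ℚ using (ℚ; 0ℚ; 1ℚ; ½)
import Data.Rational.Properties as ℚ
open import Data.Rational.Unnormalised as ℚᵘ using (mkℚᵘ; *≡*)
import Data.Rational.Unnormalised.Properties as ℚᵘ
open import Data.Sum using (inj₁; inj₂)
open import Data.Unit using (tt)
open import Function using (_∘_; id; mk⇔)
open import Relation.Binary.Definitions using (tri<; tri≈; tri>)
open import Relation.Binary.PropositionalEquality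

true≢false : true ≢ false
true≢false ()

∧-intro : ∀ {x y} → x ≡ true → y ≡ true → (x ∧ y) ≡ true
∧-intro refl refl = refl

∨-introˡ : ∀ {x} y → x ≡ true → (x ∨ y) ≡ true
∨-introˡ y refl = refl

∨-introʳ : ∀ x {y} → y ≡ true → (x ∨ y) ≡ true
∨-introʳ x refl = ∨-zeroʳ x

≡ᵇ-refl : ∀ n → (n ≡ᵇ n) ≡ true
≡ᵇ-refl zero    = refl
≡ᵇ-refl (suc n) = ≡ᵇ-refl n

≡ᵇ-sym : ∀ m n → (m ≡ᵇ n) ≡ (n ≡ᵇ m)
≡ᵇ-sym zero    zero    = refl
≡ᵇ-sym zero    (suc n) = refl
≡ᵇ-sym (suc m) zero    = refl
≡ᵇ-sym (suc m) (suc n) = ≡ᵇ-sym m n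

≡ᵇ-true⇒≡ : ∀ m n → (m ≡ᵇ n) ≡ true → m ≡ n
≡ᵇ-true⇒≡ m n e = ≡ᵇ⇒≡ m n (subst T (sym e) tt)

≡ᵇ-false⇒≢ : ∀ m n → (m ≡ᵇ n) ≡ false → m ≢ n
≡ᵇ-false⇒≢ m .m e refl with () ← trans (sym (≡ᵇ-refl m)) e

≢⇒≡ᵇ-false : ∀ m n → m ≢ n → (m ≡ᵇ n) ≡ false
≢⇒≡ᵇ-false m n m≢n with m ≡ᵇ n in e
... | true  = ⊥-elim (m≢n (≡ᵇ-true⇒≡ m n e))
... | false = refl

<⇒<ᵇ-true : ∀ m n → m < n → (m <ᵇ n) ≡ true
<⇒<ᵇ-true m n m<n with m <ᵇ n in e
... | true  = refl
... | false = ⊥-elim (subst T e (<⇒<ᵇ m<n))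

≥⇒<ᵇ-false : ∀ m n → n ≤ m → (m <ᵇ n) ≡ false
≥⇒<ᵇ-false m n n≤m with m <ᵇ n in e
... | true  = ⊥-elim (<⇒≱ (<ᵇ⇒< m n (subst T (sym e) tt)) n≤m)
... | false = refl

≤ᵇ-true⇒≤ : ∀ m n → (m ≤ᵇ n) ≡ true → m ≤ n
≤ᵇ-true⇒≤ m n e = ≤ᵇ⇒≤ m n (subst T (sym e) tt)

≤⇒≤ᵇ-true : ∀ m n → m ≤ n → (m ≤ᵇ n) ≡ true
≤⇒≤ᵇ-true m n m≤n with m ≤ᵇ n in e
... | true  = refl
... | false = ⊥-elim (subst T e (≤⇒≤ᵇ m≤n))

>⇒≤ᵇ-false : ∀ m n → n < m → (m ≤ᵇ n) ≡ false
>⇒≤ᵇ-false m n n<m with m ≤ᵇ n in e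
... | true  = ⊥-elim (<⇒≱ n<m (≤ᵇ-true⇒≤ m n e))
... | false = refl

≤ᵇ-false⇒> : ∀ m n → (m ≤ᵇ n) ≡ false → n < m
≤ᵇ-false⇒> m n e = ≰⇒> (λ m≤n → subst T e (≤⇒≤ᵇ m≤n))

<ᵇ-suc≡≤ᵇ : ∀ m n → (m <ᵇ suc n) ≡ (m ≤ᵇ n)
<ᵇ-suc≡≤ᵇ zero    n = refl
<ᵇ-suc≡≤ᵇ (suc m) n = refl

<ᵇ-suc : ∀ b w → (b <ᵇ suc w) ≡ ((b <ᵇ w) ∨ (b ≡ᵇ w))
<ᵇ-suc zero    zero    = refl
<ᵇ-suc zero    (suc w) = refl
<ᵇ-suc (suc b) zero    = refl
<ᵇ-suc (suc b) (suc w) = <ᵇ-suc b w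

<ᵇ-∧-≡ᵇ : ∀ b a → ((b <ᵇ a) ∧ (b ≡ᵇ a)) ≡ false
<ᵇ-∧-≡ᵇ zero    zero    = refl
<ᵇ-∧-≡ᵇ zero    (suc a) = refl
<ᵇ-∧-≡ᵇ (suc b) zero    = refl
<ᵇ-∧-≡ᵇ (suc b) (suc a) = <ᵇ-∧-≡ᵇ b a


count : ℕ → List ℕ → ℕ
count v = countBy (_≡ᵇ v)

remove : ℕ → List ℕ → List ℕ
remove v []      = []
remove v (a ∷ α) = if a ≡ᵇ v then remove v α else a ∷ remove v α

member-head : ∀ a α → member a (a ∷ α) ≡ true
member-head a α rewrite ≡ᵇ-refl a = refl

member-∷ : ∀ a b α → member a α ≡ true → member a (b ∷ α) ≡ true
member-∷ a b α a∈α with a ≡ᵇ b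
... | true  = refl
... | false = a∈α

count-∷-self : ∀ a α → count a (a ∷ α) ≡ suc (count a α)
count-∷-self a α rewrite ≡ᵇ-refl a = refl

member≡not[count≡ᵇ0] : ∀ a α → member a α ≡ not (count a α ≡ᵇ 0)
member≡not[count≡ᵇ0] a []      = refl
member≡not[count≡ᵇ0] a (b ∷ α) rewrite ≡ᵇ-sym b a with a ≡ᵇ b
... | true  = refl
... | false = member≡not[count≡ᵇ0] a α

member⇒count>0 : ∀ a α → member a α ≡ true → 0 < count a α
member⇒count>0 a α a∈α with count a α | member≡not[count≡ᵇ0] a α
... | zero  | e with () ← trans (sym e) a∈α
... | suc _ | _ = s≤s z≤n

count>0⇒member : ∀ a α → 0 < count a α → member a α ≡ true
count>0⇒member a α c>0 with count a α | member≡not[count≡ᵇ0] a α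
... | suc _ | e = e

¬member⇒count≡0 : ∀ a α → member a α ≡ false → count a α ≡ 0
¬member⇒count≡0 a α a∉α with count a α | member≡not[count≡ᵇ0] a α
... | zero  | _ = refl
... | suc _ | e with () ← trans (sym a∉α) e

count+length-remove : ∀ v α → count v α + length (remove v α) ≡ length α
count+length-remove v []      = refl
count+length-remove v (a ∷ α) with a ≡ᵇ v
... | true  = cong suc (count+length-remove v α)
... | false = trans (+-suc _ _) (cong suc (count+length-remove v α))

member-remove : ∀ a v α → member a (remove v α) ≡ (not (a ≡ᵇ v) ∧ member a α)
member-remove a v []      with a ≡ᵇ v
... | true  = refl
... | false = refl
member-remove a v (b ∷ α) with b ≡ᵇ v in b≡v
... | true rewrite ≡ᵇ-true⇒≡ b v b≡v with a ≡ᵇ v | member-remove a v α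
...   | true  | ih = ih
...   | false | ih = ih
member-remove a v (b ∷ α) | false with a ≡ᵇ b in a≡b
... | true rewrite ≡ᵇ-true⇒≡ a b a≡b | b≡v = refl
... | false = member-remove a v α

member-remove⇒ : ∀ a v α → member a (remove v α) ≡ true → a ≢ v × member a α ≡ true
member-remove⇒ a v α a∈ rewrite member-remove a v α with a ≡ᵇ v in a≡v | member a α
... | false | true = ≡ᵇ-false⇒≢ a v a≡v , refl

remove-¬member : ∀ v α → member v α ≡ false → remove v α ≡ α
remove-¬member v []      _   = refl
remove-¬member v (a ∷ α) v∉ rewrite ≡ᵇ-sym a v with v ≡ᵇ a
... | false = cong (a ∷_) (remove-¬member v α v∉)

count-remove-≢ : ∀ a v α → a ≢ v → count a (remove v α) ≡ count a α
count-remove-≢ a v []      _   = refl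
count-remove-≢ a v (b ∷ α) a≢v with b ≡ᵇ v in b≡v
... | true rewrite ≡ᵇ-true⇒≡ b v b≡v | ≢⇒≡ᵇ-false v a (a≢v ∘ sym) = count-remove-≢ a v α a≢v
... | false with b ≡ᵇ a
...   | true  = cong suc (count-remove-≢ a v α a≢v)
...   | false = count-remove-≢ a v α a≢v

countBy-remove : ∀ p v α → countBy p α ≡ countBy p (remove v α) + (if p v then count v α else 0)
countBy-remove p v []      with p v
... | true  = refl
... | false = refl
countBy-remove p v (b ∷ α) with b ≡ᵇ v in b≡v
... | true rewrite ≡ᵇ-true⇒≡ b v b≡v with p v | countBy-remove p v α
...   | true  | ih = trans (cong suc ih) (sym (+-suc _ _))
...   | false | ih = ih
countBy-remove p v (b ∷ α) | false with p b
... | true  = cong suc (countBy-remove p v α)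
... | false = countBy-remove p v α

countBy≤length : ∀ p α → countBy p α ≤ length α
countBy≤length p []      = z≤n
countBy≤length p (a ∷ α) with p a
... | true  = s≤s (countBy≤length p α)
... | false = m≤n⇒m≤1+n (countBy≤length p α)

countBy<length : ∀ p α a → member a α ≡ true → p a ≡ false → countBy p α < length α
countBy<length p (b ∷ α) a a∈ pa≡false with a ≡ᵇ b in a≡b
... | true rewrite ≡ᵇ-true⇒≡ a b a≡b | pa≡false = s≤s (countBy≤length p α)
... | false with p b
...   | true  = s≤s (countBy<length p α a a∈ pa≡false)
...   | false = m<n⇒m<1+n (countBy<length p α a a∈ pa≡false)

countBy-cong : ∀ {p q} α → (∀ b → p b ≡ q b) → countBy p α ≡ countBy q α
countBy-cong             []      _   = refl
countBy-cong {p} {q} (b ∷ α) p≗q rewrite p≗q b with q b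
... | true  = cong suc (countBy-cong α p≗q)
... | false = countBy-cong α p≗q

countBy-all : ∀ p α → (∀ a → member a α ≡ true → p a ≡ true) → countBy p α ≡ length α
countBy-all p []      _   = refl
countBy-all p (b ∷ α) all rewrite all b (member-head b α) =
  cong suc (countBy-all p α (λ a a∈ → all a (member-∷ a b α a∈)))

countBy-∨ : ∀ p q α → (∀ b → (p b ∧ q b) ≡ false) →
            countBy (λ b → p b ∨ q b) α ≡ countBy p α + countBy q α
countBy-∨ p q []      _        = refl
countBy-∨ p q (b ∷ α) disjoint with p b | q b | disjoint b | countBy-∨ p q α disjoint
... | true  | false | _ | ih = cong suc ih
... | false | true  | _ | ih = trans (cong suc ih) (sym (+-suc _ _))
... | false | false | _ | ih = ih

countBy-<ᵇ-suc : ∀ w γ → countBy (_<ᵇ suc w) γ ≡ countBy (_<ᵇ w) γ + count w γ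
countBy-<ᵇ-suc w γ =
  trans (countBy-cong γ (λ b → <ᵇ-suc b w)) (countBy-∨ (_<ᵇ w) (_≡ᵇ w) γ (λ b → <ᵇ-∧-≡ᵇ b w))

allB⇒ : ∀ p α a → allB p α ≡ true → member a α ≡ true → p a ≡ true
allB⇒ p (b ∷ α) a all a∈ with a ≡ᵇ b in a≡b
... | true rewrite ≡ᵇ-true⇒≡ a b a≡b = ∧-conicalˡ (p b) _ all
... | false = allB⇒ p α a (∧-conicalʳ (p b) _ all) a∈

allB-cong : ∀ p q α → (∀ a → member a α ≡ true → p a ≡ q a) → allB p α ≡ allB q α
allB-cong p q []      _  = refl
allB-cong p q (b ∷ α) eq =
  cong₂ _∧_ (eq b (member-head b α)) (allB-cong p q α (λ a a∈ → eq a (member-∷ a b α a∈)))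

allB-remove : ∀ p v α → allB p α ≡ (allB p (remove v α) ∧ (not (member v α) ∨ p v))
allB-remove p v []      = refl
allB-remove p v (b ∷ α) with b ≡ᵇ v in b≡v
... | true rewrite ≡ᵇ-true⇒≡ b v b≡v | ≡ᵇ-refl v with p v | allB-remove p v α
...   | true  | ih = trans ih (cong (allB p (remove v α) ∧_) (∨-zeroʳ _))
...   | false | _  = sym (∧-zeroʳ _)
allB-remove p v (b ∷ α) | false rewrite ≡ᵇ-sym v b | b≡v with p b
... | true  = allB-remove p v α
... | false = refl

maximum : List ℕ → ℕ
maximum []      = 0
maximum (a ∷ α) = a ⊔ maximum α

member⇒≤maximum : ∀ a α → member a α ≡ true → a ≤ maximum α
member⇒≤maximum a (b ∷ α) a∈ with a ≡ᵇ b in a≡b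
... | true rewrite ≡ᵇ-true⇒≡ a b a≡b = m≤m⊔n b (maximum α)
... | false = ≤-trans (member⇒≤maximum a α a∈) (m≤n⊔m b (maximum α))

maximum-member : ∀ b α → member (maximum (b ∷ α)) (b ∷ α) ≡ true
maximum-member b []      rewrite ⊔-identityʳ b = member-head b []
maximum-member b (c ∷ α) with ⊔-sel b (maximum (c ∷ α))
... | inj₁ b⊔m≡b rewrite b⊔m≡b = member-head b (c ∷ α)
... | inj₂ b⊔m≡m rewrite b⊔m≡m = member-∷ _ b (c ∷ α) (maximum-member c α)


freshCount : List ℕ → List ℕ → ℕ
freshCount seen []      = 0
freshCount seen (a ∷ α) = (if member a seen then 0 else 1) + freshCount (a ∷ seen) α

distinct : List ℕ → ℕ
distinct = freshCount []

SameMembers : List ℕ → List ℕ → Set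
SameMembers S S′ = ∀ s → member s S ≡ member s S′

SameMembers-∷ : ∀ a S S′ → SameMembers S S′ → SameMembers (a ∷ S) (a ∷ S′)
SameMembers-∷ a S S′ S∼S′ s with s ≡ᵇ a
... | true  = refl
... | false = S∼S′ s

SameMembers-swap : ∀ a b S → SameMembers (a ∷ b ∷ S) (b ∷ a ∷ S)
SameMembers-swap a b S s with s ≡ᵇ a | s ≡ᵇ b
... | true  | true  = refl
... | true  | false = refl
... | false | true  = refl
... | false | false = refl

SameMembers-dup : ∀ v S → member v S ≡ true → SameMembers (v ∷ S) S
SameMembers-dup v S v∈S s with s ≡ᵇ v in s≡v
... | true rewrite ≡ᵇ-true⇒≡ s v s≡v = sym v∈S
... | false = refl

freshCount-cong : ∀ S S′ α → SameMembers S S′ → freshCount S α ≡ freshCount S′ α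
freshCount-cong S S′ []      _    = refl
freshCount-cong S S′ (a ∷ α) S∼S′ rewrite S∼S′ a =
  cong (_ +_) (freshCount-cong (a ∷ S) (a ∷ S′) α (SameMembers-∷ a S S′ S∼S′))

freshCount-∷-absent : ∀ v seen α → member v α ≡ false → freshCount (v ∷ seen) α ≡ freshCount seen α
freshCount-∷-absent v seen []      _   = refl
freshCount-∷-absent v seen (b ∷ α) v∉ with v ≡ᵇ b in v≡b
... | false rewrite ≡ᵇ-sym b v | v≡b = cong (_ +_) (begin
  freshCount (b ∷ v ∷ seen) α  ≡⟨ freshCount-cong _ _ α (SameMembers-swap b v seen) ⟩
  freshCount (v ∷ b ∷ seen) α  ≡⟨ freshCount-∷-absent v (b ∷ seen) α v∉ ⟩
  freshCount (b ∷ seen) α      ∎)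
  where open ≡-Reasoning

freshCount-remove-seen : ∀ v seen α → member v seen ≡ true →
                         freshCount seen α ≡ freshCount seen (remove v α)
freshCount-remove-seen v seen []      _    = refl
freshCount-remove-seen v seen (a ∷ α) v∈ with a ≡ᵇ v in a≡v
... | true rewrite ≡ᵇ-true⇒≡ a v a≡v | v∈ =
  trans (freshCount-cong _ _ α (SameMembers-dup v seen v∈)) (freshCount-remove-seen v seen α v∈)
... | false = cong (_ +_) (freshCount-remove-seen v (a ∷ seen) α (member-∷ v a seen v∈))

freshCount-remove-unseen : ∀ v seen α → member v seen ≡ false →
                           freshCount seen α ≡ freshCount seen (remove v α) + (if member v α then 1 else 0)
freshCount-remove-unseen v seen []      _  = sym (+-identityʳ _)
freshCount-remove-unseen v seen (a ∷ α) v∉ with a ≡ᵇ v in a≡v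
... | true rewrite ≡ᵇ-true⇒≡ a v a≡v | v∉ | ≡ᵇ-refl v = begin
  suc (freshCount (v ∷ seen) α)               ≡⟨ cong suc (freshCount-remove-seen v _ α (member-head v seen)) ⟩
  suc (freshCount (v ∷ seen) (remove v α))    ≡⟨ cong suc (freshCount-∷-absent v seen (remove v α) v∉rest) ⟩
  suc (freshCount seen (remove v α))          ≡⟨ +-comm 1 _ ⟩
  freshCount seen (remove v α) + 1            ∎
  where
  open ≡-Reasoning
  v∉rest : member v (remove v α) ≡ false
  v∉rest rewrite member-remove v v α | ≡ᵇ-refl v = refl
... | false rewrite ≡ᵇ-sym v a | a≡v = begin
  new + freshCount (a ∷ seen) α
    ≡⟨ cong (new +_) (freshCount-remove-unseen v _ α v∉a∷seen) ⟩
  new + (freshCount (a ∷ seen) (remove v α) + last)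
    ≡⟨ +-assoc new _ last ⟨
  new + freshCount (a ∷ seen) (remove v α) + last
    ∎
  where
  open ≡-Reasoning
  new  = if member a seen then 0 else 1
  last = if member v α then 1 else 0
  v∉a∷seen : member v (a ∷ seen) ≡ false
  v∉a∷seen rewrite ≡ᵇ-sym v a | a≡v = v∉

distinct-remove : ∀ v α → member v α ≡ true → distinct α ≡ suc (distinct (remove v α))
distinct-remove v α v∈ rewrite freshCount-remove-unseen v [] α refl | v∈ = +-comm _ 1


interval : ℕ → ℕ → List ℕ
interval s zero    = []
interval s (suc c) = s ∷ interval (suc s) c

applyUpTo≡interval : ∀ (f : ℕ → ℕ) s c → (∀ i → f i ≡ s + i) → applyUpTo f c ≡ interval s c
applyUpTo≡interval f s zero    _  = refl
applyUpTo≡interval f s (suc c) f≗ =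
  cong₂ _∷_ (trans (f≗ 0) (+-identityʳ s))
            (applyUpTo≡interval (f ∘ suc) (suc s) c (λ i → trans (f≗ (suc i)) (+-suc s i)))

oneTo≡interval : ∀ m → oneTo m ≡ interval 1 m
oneTo≡interval m = trans (map-upTo suc m) (applyUpTo≡interval suc 1 m (λ _ → refl))

count-interval-below : ∀ v s c → v < s → count v (interval s c) ≡ 0
count-interval-below v s zero    _   = refl
count-interval-below v s (suc c) v<s rewrite ≢⇒≡ᵇ-false s v (λ s≡v → <-irrefl (sym s≡v) v<s) =
  count-interval-below v (suc s) c (m<n⇒m<1+n v<s)

count-interval : ∀ v s c → s ≤ v → v < s + c → count v (interval s c) ≡ 1
count-interval v s zero    s≤v v<s+0 = ⊥-elim (<⇒≱ v<s+0 (subst (_≤ v) (sym (+-identityʳ s)) s≤v))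
count-interval v s (suc c) s≤v v<s+c with s ≡ᵇ v in s≡v
... | true rewrite ≡ᵇ-true⇒≡ s v s≡v = cong suc (count-interval-below v (suc v) c (n<1+n v))
... | false =
  count-interval v (suc s) c (≤∧≢⇒< s≤v (≡ᵇ-false⇒≢ s v s≡v)) (subst (v <_) (+-suc s c) v<s+c)

count-oneTo : ∀ v m → 0 < v → v ≤ m → count v (oneTo m) ≡ 1
count-oneTo v m v>0 v≤m rewrite oneTo≡interval m = count-interval v 1 m v>0 (s≤s v≤m)

interval-++ : ∀ s a b → interval s (a + b) ≡ interval s a ++ interval (s + a) b
interval-++ s zero    b rewrite +-identityʳ s = refl
interval-++ s (suc a) b rewrite +-suc s a = cong (s ∷_) (interval-++ (suc s) a b)

filter-≤-interval-all : ∀ a s c → a ≤ s → filter (a ≤?_) (interval s c) ≡ interval s c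
filter-≤-interval-all a s zero    _   = refl
filter-≤-interval-all a s (suc c) a≤s rewrite ≤⇒≤ᵇ-true a s a≤s =
  cong (s ∷_) (filter-≤-interval-all a (suc s) c (m≤n⇒m≤1+n a≤s))

filter-≤-interval : ∀ a s c → s ≤ a → filter (a ≤?_) (interval s c) ≡ interval a (s + c ∸ a)
filter-≤-interval a s zero    s≤a rewrite +-identityʳ s | m≤n⇒m∸n≡0 s≤a = refl
filter-≤-interval a s (suc c) s≤a with a ≤ᵇ s in a≤ᵇs
... | true rewrite ≤-antisym s≤a (≤ᵇ-true⇒≤ a s a≤ᵇs) | m+n∸m≡n a (suc c) =
  cong (a ∷_) (filter-≤-interval-all a (suc a) c (n≤1+n a))
... | false rewrite +-suc s c = filter-≤-interval a (suc s) c (≤ᵇ-false⇒> a s a≤ᵇs)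


-- Unit Fubini rankings

unitFubini-value : ∀ γ a → isUnitFubini γ ≡ true → member a γ ≡ true → a ≡ suc (countBy (_<ᵇ a) γ)
unitFubini-value γ a ufr a∈ = ≡ᵇ-true⇒≡ _ _ (allB⇒ _ γ a (∧-conicalˡ _ _ ufr) a∈)

unitFubini-value≤length : ∀ γ a → isUnitFubini γ ≡ true → member a γ ≡ true → a ≤ length γ
unitFubini-value≤length γ a ufr a∈ rewrite unitFubini-value γ a ufr a∈ =
  countBy<length _ γ a a∈ (≥⇒<ᵇ-false a a ≤-refl)

-- The value a claims the spots a, …, a + count a γ - 1; these blocks lie in 1, …, n and are disjoint.
record BlocksFit (γ : List ℕ) (n : ℕ) : Set where
  field
    positive    : ∀ a → member a γ ≡ true → 0 < a
    fits        : ∀ a → member a γ ≡ true → a + count a γ ≤ suc n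
    count≤2     : ∀ a → count a γ ≤ 2
    gapAfterTie : ∀ w → count w γ ≡ 2 → member (suc w) γ ≡ false

unitFubini⇒BlocksFit : ∀ γ → isUnitFubini γ ≡ true → BlocksFit γ (length γ)
unitFubini⇒BlocksFit γ ufr = record
  { positive    = λ a a∈ → subst (0 <_) (sym (value a a∈)) (s≤s z≤n)
  ; fits        = fits
  ; count≤2     = count≤2
  ; gapAfterTie = gapAfterTie
  }
  where
  value : ∀ a → member a γ ≡ true → a ≡ suc (countBy (_<ᵇ a) γ)
  value a = unitFubini-value γ a ufr

  fits : ∀ a → member a γ ≡ true → a + count a γ ≤ suc (length γ)
  fits a a∈ = subst (λ x → x + count a γ ≤ suc (length γ)) (sym (value a a∈))
    (s≤s (subst (_≤ length γ) (countBy-<ᵇ-suc a γ) (countBy≤length _ γ)))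

  count≤2 : ∀ a → count a γ ≤ 2
  count≤2 a with member a γ in a∈?
  ... | true  = ≤ᵇ-true⇒≤ _ 2 (allB⇒ _ γ a (∧-conicalʳ _ _ ufr) a∈?)
  ... | false rewrite ¬member⇒count≡0 a γ a∈? = z≤n

  gapAfterTie : ∀ w → count w γ ≡ 2 → member (suc w) γ ≡ false
  gapAfterTie w tie with member (suc w) γ in sw∈
  ... | false = refl
  ... | true  = ⊥-elim (1+n≢n (sym (begin
    suc (suc c)                    ≡⟨ cong suc (value w w∈) ⟨
    suc w                          ≡⟨ value (suc w) sw∈ ⟩
    suc (countBy (_<ᵇ suc w) γ)    ≡⟨ cong suc (countBy-<ᵇ-suc w γ) ⟩
    suc (c + count w γ)            ≡⟨ cong (λ k → suc (c + k)) tie ⟩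
    suc (c + 2)                    ≡⟨ cong suc (+-comm c 2) ⟩
    suc (suc (suc c))              ∎)))
    where
    open ≡-Reasoning
    w∈ : member w γ ≡ true
    w∈ = count>0⇒member w γ (subst (0 <_) (sym tie) (s≤s z≤n))
    c = countBy (_<ᵇ w) γ

unitFubini-remove-top : ∀ v α → member v α ≡ true → (∀ a → member a (remove v α) ≡ true → a < v) →
  isUnitFubini α ≡ (isUnitFubini (remove v α) ∧ ((v ≡ᵇ suc (length (remove v α))) ∧ (count v α ≤ᵇ 2)))
unitFubini-remove-top v α v∈α below =
  trans (cong₂ _∧_ ranking twice) (interchange (isFubiniRanking β) _ (atMostTwice β) _)
  where
  open CommSemigroupProperties (CommutativeMonoid.commutativeSemigroup ∧-commutativeMonoid)
  β = remove v α

  countBelow : ∀ a → a ≤ v → countBy (_<ᵇ a) α ≡ countBy (_<ᵇ a) β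
  countBelow a a≤v = begin
    countBy (_<ᵇ a) α                                          ≡⟨ countBy-remove (_<ᵇ a) v α ⟩
    countBy (_<ᵇ a) β + (if v <ᵇ a then count v α else 0)
      ≡⟨ cong (λ b → countBy (_<ᵇ a) β + (if b then count v α else 0)) (≥⇒<ᵇ-false v a a≤v) ⟩
    countBy (_<ᵇ a) β + 0                                      ≡⟨ +-identityʳ _ ⟩
    countBy (_<ᵇ a) β                                          ∎
    where open ≡-Reasoning

  ranking : isFubiniRanking α ≡ (isFubiniRanking β ∧ (v ≡ᵇ suc (length β)))
  ranking = trans (allB-remove _ v α) (cong₂ _∧_
    (allB-cong _ _ β (λ a a∈β → cong (λ c → a ≡ᵇ suc c) (countBelow a (<⇒≤ (below a a∈β)))))
    (trans (cong (λ b → not b ∨ (v ≡ᵇ suc (countBy (_<ᵇ v) α))) v∈α)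
           (cong (λ c → v ≡ᵇ suc c)
                 (trans (countBelow v ≤-refl) (countBy-all _ β (λ a a∈β → <⇒<ᵇ-true a v (below a a∈β)))))))

  twice : atMostTwice α ≡ (atMostTwice β ∧ (count v α ≤ᵇ 2))
  twice = trans (allB-remove _ v α) (cong₂ _∧_
    (allB-cong _ _ β (λ a a∈β →
      cong (_≤ᵇ 2) (sym (count-remove-≢ a v α (proj₁ (member-remove⇒ a v α a∈β))))))
    (cong (λ b → not b ∨ (count v α ≤ᵇ 2)) v∈α))


-- Lucky cars

parkSpot≡firstFree : ∀ n occ a → 0 < a → parkSpot n occ a ≡ firstFree occ (interval a (suc n ∸ a))
parkSpot≡firstFree n occ a a>0 rewrite oneTo≡interval n = cong (firstFree occ) (filter-≤-interval a 1 n a>0)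

parkSpot-free : ∀ n occ a → 0 < a → a ≤ n → member a occ ≡ false → parkSpot n occ a ≡ just a
parkSpot-free n occ a a>0 a≤n a∉ rewrite parkSpot≡firstFree n occ a a>0 | +-∸-assoc 1 a≤n | a∉ = refl

parkSpot-next : ∀ n occ a → 0 < a → suc a ≤ n → member a occ ≡ true → member (suc a) occ ≡ false →
                parkSpot n occ a ≡ just (suc a)
parkSpot-next n occ a a>0 a<n a∈ sa∉
  rewrite parkSpot≡firstFree n occ a a>0 | +-∸-assoc 1 (<⇒≤ a<n) | +-∸-assoc 1 a<n | a∈ | sa∉ = refl

module Parking {γ : List ℕ} {n : ℕ} (fit : BlocksFit γ n) where
  open BlocksFit fit

  -- After the cars with preferences `seen` have parked, the occupied spots are the
  -- values seen so far together with w + 1 for every value w seen twice.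
  secondSpot : List ℕ → ℕ → Bool
  secondSpot seen zero    = false
  secondSpot seen (suc w) = count w seen ≡ᵇ 2

  Occupied : List ℕ → List ℕ → Set
  Occupied seen occ = ∀ s → member s occ ≡ (member s seen ∨ secondSpot seen s)

  Pending : List ℕ → List ℕ → Set
  Pending seen rest = ∀ v → count v seen + count v rest ≡ count v γ

  Pending-step : ∀ seen a r → Pending seen (a ∷ r) → Pending (a ∷ seen) r
  Pending-step seen a r pending v with a ≡ᵇ v | pending v
  ... | true  | eq = trans (sym (+-suc _ _)) eq
  ... | false | eq = eq

  seen≤γ : ∀ seen rest v → Pending seen rest → count v seen ≤ count v γ
  seen≤γ seen rest v pending = subst (count v seen ≤_) (pending v) (m≤m+n _ _)

  seen<γ : ∀ seen a r → Pending seen (a ∷ r) → count a seen < count a γ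
  seen<γ seen a r pending = subst (count a seen <_) (pending a)
    (subst (λ k → count a seen < count a seen + k) (sym (count-∷-self a r)) (m<m+n _ (s≤s z≤n)))

  secondSpot-∷ : ∀ a seen s → s ≢ suc a → secondSpot (a ∷ seen) s ≡ secondSpot seen s
  secondSpot-∷ a seen zero    _   = refl
  secondSpot-∷ a seen (suc w) s≢ rewrite ≢⇒≡ᵇ-false a w (λ a≡w → s≢ (cong suc (sym a≡w))) = refl

  secondSpot-∷-fresh : ∀ a seen s → count a seen ≡ 0 → secondSpot (a ∷ seen) s ≡ secondSpot seen s
  secondSpot-∷-fresh a seen zero    _     = refl
  secondSpot-∷-fresh a seen (suc w) fresh with a ≡ᵇ w in a≡w
  ... | true rewrite sym (≡ᵇ-true⇒≡ a w a≡w) | fresh = refl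
  ... | false = refl

  park-fresh : ∀ seen occ a r → Pending seen (a ∷ r) → Occupied seen occ → member a seen ≡ false →
               parkSpot n occ a ≡ just a × Occupied (a ∷ seen) (a ∷ occ)
  park-fresh seen occ a r pending occupied a∉seen =
    parkSpot-free n occ a (positive a a∈γ) a≤n a∉occ , occupied′
    where
    a∈γ : member a γ ≡ true
    a∈γ = count>0⇒member a γ (≤-trans (s≤s z≤n) (seen<γ seen a r pending))

    a≤n : a ≤ n
    a≤n = ≤-pred (begin
      suc a            ≡⟨ +-comm 1 a ⟩
      a + 1            ≤⟨ +-monoʳ-≤ a (member⇒count>0 a γ a∈γ) ⟩
      a + count a γ    ≤⟨ fits a a∈γ ⟩
      suc n            ∎)
      where open ≤-Reasoning

    noTieBelow : ∀ s → member s γ ≡ true → secondSpot seen s ≡ false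
    noTieBelow zero    _   = refl
    noTieBelow (suc w) s∈γ with count w seen ≡ᵇ 2 in seenTwice
    ... | false = refl
    ... | true = ⊥-elim (true≢false (trans (sym s∈γ) (gapAfterTie w tie)))
      where
      tie : count w γ ≡ 2
      tie = ≤-antisym (count≤2 w)
              (subst (_≤ count w γ) (≡ᵇ-true⇒≡ _ 2 seenTwice) (seen≤γ seen (a ∷ r) w pending))

    a∉occ : member a occ ≡ false
    a∉occ rewrite occupied a | a∉seen = noTieBelow a a∈γ

    occupied′ : Occupied (a ∷ seen) (a ∷ occ)
    occupied′ s with s ≡ᵇ a
    ... | true  = refl
    ... | false = trans (occupied s)
                    (cong (member s seen ∨_) (sym (secondSpot-∷-fresh a seen s (¬member⇒count≡0 a seen a∉seen))))

  park-repeat : ∀ seen occ a r → Pending seen (a ∷ r) → Occupied seen occ → member a seen ≡ true →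
                parkSpot n occ a ≡ just (suc a) × Occupied (a ∷ seen) (suc a ∷ occ)
  park-repeat seen occ a r pending occupied a∈seen =
    parkSpot-next n occ a (positive a a∈γ) sa≤n a∈occ sa∉occ , occupied′
    where
    seen<γ′ : count a seen < count a γ
    seen<γ′ = seen<γ seen a r pending

    a∈γ : member a γ ≡ true
    a∈γ = count>0⇒member a γ (≤-trans (s≤s z≤n) seen<γ′)

    tie : count a γ ≡ 2
    tie = ≤-antisym (count≤2 a) (≤-trans (s≤s (member⇒count>0 a seen a∈seen)) seen<γ′)

    seenOnce : count a seen ≡ 1
    seenOnce = ≤-antisym (≤-pred (subst (count a seen <_) tie seen<γ′)) (member⇒count>0 a seen a∈seen)

    sa≤n : suc a ≤ n
    sa≤n = ≤-pred (subst (_≤ suc n) (trans (cong (a +_) tie) (+-comm a 2)) (fits a a∈γ))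

    a∈occ : member a occ ≡ true
    a∈occ rewrite occupied a | a∈seen = refl

    sa∉seen : member (suc a) seen ≡ false
    sa∉seen with member (suc a) seen in sa∈?
    ... | false = refl
    ... | true = ⊥-elim (true≢false (trans (sym (count>0⇒member (suc a) γ sa∈γ)) (gapAfterTie a tie)))
      where
      sa∈γ : 0 < count (suc a) γ
      sa∈γ = ≤-trans (member⇒count>0 (suc a) seen sa∈?) (seen≤γ seen (a ∷ r) (suc a) pending)

    sa∉occ : member (suc a) occ ≡ false
    sa∉occ rewrite occupied (suc a) | sa∉seen | seenOnce = refl

    occupied′ : Occupied (a ∷ seen) (suc a ∷ occ)
    occupied′ s with s ≡ᵇ suc a in s≡sa
    ... | true rewrite ≡ᵇ-true⇒≡ s (suc a) s≡sa | count-∷-self a seen | seenOnce = sym (∨-zeroʳ _)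
    ... | false with s ≡ᵇ a in s≡a
    ...   | true rewrite ≡ᵇ-true⇒≡ s a s≡a = a∈occ
    ...   | false = trans (occupied s)
                      (cong (member s seen ∨_) (sym (secondSpot-∷ a seen s (≡ᵇ-false⇒≢ s (suc a) s≡sa))))

  luckyAux≡freshCount : ∀ seen occ rest → Pending seen rest → Occupied seen occ →
                        luckyAux n occ rest ≡ freshCount seen rest
  luckyAux≡freshCount seen occ []      _       _        = refl
  luckyAux≡freshCount seen occ (a ∷ r) pending occupied with member a seen in a∈seen?
  ... | false with park-fresh seen occ a r pending occupied a∈seen?
  ...   | parks , occupied′ rewrite parks | ≡ᵇ-refl a =
    cong suc (luckyAux≡freshCount (a ∷ seen) (a ∷ occ) r (Pending-step seen a r pending) occupied′)
  luckyAux≡freshCount seen occ (a ∷ r) pending occupied | true with park-repeat seen occ a r pending occupied a∈seen?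
  ...   | parks , occupied′ rewrite parks | ≢⇒≡ᵇ-false (suc a) a 1+n≢n =
    luckyAux≡freshCount (a ∷ seen) (suc a ∷ occ) r (Pending-step seen a r pending) occupied′

luckyCars≡distinct : ∀ γ → isUnitFubini γ ≡ true → luckyCars (length γ) γ ≡ distinct γ
luckyCars≡distinct γ ufr = luckyAux≡freshCount [] [] γ (λ _ → refl) nothingOccupied
  where
  open Parking (unitFubini⇒BlocksFit γ ufr)
  nothingOccupied : Occupied [] []
  nothingOccupied zero    = refl
  nothingOccupied (suc s) = refl


-- Counting tuples

sum-map-cong : ∀ {f g : ℕ → ℕ} L → (∀ a → f a ≡ g a) → sum (map f L) ≡ sum (map g L)
sum-map-cong L f≗g = cong sum (map-cong f≗g L)

sum-map-0 : ∀ (f : ℕ → ℕ) L → (∀ a → f a ≡ 0) → sum (map f L) ≡ 0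
sum-map-0 f []      _   = refl
sum-map-0 f (a ∷ L) f≗0 rewrite f≗0 a = sum-map-0 f L f≗0

sum-map-+ : ∀ (f g : ℕ → ℕ) L → sum (map (λ a → f a + g a) L) ≡ sum (map f L) + sum (map g L)
sum-map-+ f g []      = refl
sum-map-+ f g (a ∷ L) rewrite sum-map-+ f g L = interchange (f a) (g a) _ _
  where open CommSemigroupProperties +-commutativeSemigroup

sum-map-interval-0 : ∀ f s c → (∀ a → s ≤ a → f a ≡ 0) → sum (map f (interval s c)) ≡ 0
sum-map-interval-0 f s zero    _   = refl
sum-map-interval-0 f s (suc c) f≗0 rewrite f≗0 s ≤-refl =
  sum-map-interval-0 f (suc s) c (λ a s<a → f≗0 a (<⇒≤ s<a))

sumExcept : ℕ → (ℕ → ℕ) → List ℕ → ℕ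
sumExcept v f L = sum (map (λ a → if a ≡ᵇ v then 0 else f a) L)

sum≡sumExcept : ∀ v f L → count v L ≡ 0 → sum (map f L) ≡ sumExcept v f L
sum≡sumExcept v f []      _  = refl
sum≡sumExcept v f (a ∷ L) v∉ with a ≡ᵇ v
... | false = cong (f a +_) (sum≡sumExcept v f L v∉)

sum-isolate : ∀ v f L → count v L ≡ 1 → sum (map f L) ≡ f v + sumExcept v f L
sum-isolate v f (a ∷ L) once with a ≡ᵇ v in a≡v
... | true rewrite ≡ᵇ-true⇒≡ a v a≡v = cong (f v +_) (sum≡sumExcept v f L (suc-injective once))
... | false = trans (cong (f a +_) (sum-isolate v f L once)) (x∙yz≈y∙xz (f a) (f v) _)
  where open CommSemigroupProperties +-commutativeSemigroup

sumExcept-cong : ∀ v {f g : ℕ → ℕ} L → (∀ a → a ≢ v → f a ≡ g a) → sumExcept v f L ≡ sumExcept v g L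
sumExcept-cong v {f} {g} L f≗g = sum-map-cong L pointwise
  where
  pointwise : ∀ a → (if a ≡ᵇ v then 0 else f a) ≡ (if a ≡ᵇ v then 0 else g a)
  pointwise a with a ≡ᵇ v in a≡v
  ... | true  = refl
  ... | false = f≗g a (≡ᵇ-false⇒≢ a v a≡v)

sumExcept-* : ∀ v c f L → sumExcept v (λ a → c * f a) L ≡ c * sumExcept v f L
sumExcept-* v c f []      = sym (*-zeroʳ c)
sumExcept-* v c f (a ∷ L) with a ≡ᵇ v
... | true  = sumExcept-* v c f L
... | false = trans (cong (c * f a +_) (sumExcept-* v c f L)) (sym (*-distribˡ-+ c (f a) _))

sumExcept-0 : ∀ v f L → (∀ a → a ≢ v → f a ≡ 0) → sumExcept v f L ≡ 0
sumExcept-0 v f []      _   = refl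
sumExcept-0 v f (a ∷ L) f≗0 with a ≡ᵇ v in a≡v
... | true  = sumExcept-0 v f L f≗0
... | false rewrite f≗0 a (≡ᵇ-false⇒≢ a v a≡v) = sumExcept-0 v f L f≗0

countTuples : ℕ → ℕ → (List ℕ → Bool) → ℕ
countTuples zero    m P = if P [] then 1 else 0
countTuples (suc n) m P = sum (map (λ a → countTuples n m (P ∘ (a ∷_))) (oneTo m))

length-filter-allTuples : ∀ n m (P : List ℕ → Bool) →
                          length (filter (T? ∘ P) (allTuples n m)) ≡ countTuples n m P
length-filter-allTuples zero    m P with P []
... | true  = refl
... | false = refl
length-filter-allTuples (suc n) m P = go (oneTo m)
  where
  length-filter-map-∷ : ∀ a X →
                        length (filter (T? ∘ P) (map (a ∷_) X)) ≡ length (filter (T? ∘ P ∘ (a ∷_)) X)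
  length-filter-map-∷ a []      = refl
  length-filter-map-∷ a (x ∷ X) with P (a ∷ x)
  ... | true  = cong suc (length-filter-map-∷ a X)
  ... | false = length-filter-map-∷ a X

  go : ∀ L → length (filter (T? ∘ P) (concatMap (λ a → map (a ∷_) (allTuples n m)) L))
             ≡ sum (map (λ a → countTuples n m (P ∘ (a ∷_))) L)
  go []      = refl
  go (a ∷ L) = begin
    length (filter (T? ∘ P) (map (a ∷_) (allTuples n m) ++ rest))
      ≡⟨ cong length (filter-++ (T? ∘ P) (map (a ∷_) (allTuples n m)) rest) ⟩
    length (filter (T? ∘ P) (map (a ∷_) (allTuples n m)) ++ filter (T? ∘ P) rest)
      ≡⟨ length-++ (filter (T? ∘ P) (map (a ∷_) (allTuples n m))) ⟩
    length (filter (T? ∘ P) (map (a ∷_) (allTuples n m))) + length (filter (T? ∘ P) rest)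
      ≡⟨ cong₂ _+_ (trans (length-filter-map-∷ a (allTuples n m)) (length-filter-allTuples n m (P ∘ (a ∷_))))
                   (go L) ⟩
    countTuples n m (P ∘ (a ∷_)) + sum (map (λ a → countTuples n m (P ∘ (a ∷_))) L)
      ∎
    where
    open ≡-Reasoning
    rest = concatMap (λ a → map (a ∷_) (allTuples n m)) L

countTuples-cong : ∀ n m {P Q : List ℕ → Bool} → (∀ α → length α ≡ n → P α ≡ Q α) →
                   countTuples n m P ≡ countTuples n m Q
countTuples-cong zero    m P≗Q rewrite P≗Q [] refl = refl
countTuples-cong (suc n) m P≗Q =
  sum-map-cong (oneTo m) (λ a → countTuples-cong n m (λ α len → P≗Q (a ∷ α) (cong suc len)))

countTuples-none : ∀ n m (P : List ℕ → Bool) → (∀ α → length α ≡ n → P α ≡ false) →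
                   countTuples n m P ≡ 0
countTuples-none zero    m P never rewrite never [] refl = refl
countTuples-none (suc n) m P never =
  sum-map-0 _ (oneTo m) (λ a → countTuples-none n m (P ∘ (a ∷_)) (λ α len → never (a ∷ α) (cong suc len)))

countTuples-∨ : ∀ n m (P Q : List ℕ → Bool) → (∀ α → length α ≡ n → (P α ∧ Q α) ≡ false) →
                countTuples n m (λ α → P α ∨ Q α) ≡ countTuples n m P + countTuples n m Q
countTuples-∨ zero    m P Q disjoint with P [] | Q [] | disjoint [] refl
... | true  | false | _ = refl
... | false | true  | _ = refl
... | false | false | _ = refl
countTuples-∨ (suc n) m P Q disjoint = trans
  (sum-map-cong (oneTo m) (λ a →
    countTuples-∨ n m (P ∘ (a ∷_)) (Q ∘ (a ∷_)) (λ α len → disjoint (a ∷ α) (cong suc len))))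
  (sum-map-+ _ _ (oneTo m))

countTuples-restrict : ∀ n m m′ P → m′ ≤ m →
                       (∀ α → length α ≡ n → P α ≡ true → ∀ a → member a α ≡ true → a ≤ m′) →
                       countTuples n m P ≡ countTuples n m′ P
countTuples-restrict zero    m m′ P _     _       = refl
countTuples-restrict (suc n) m m′ P m′≤m bounded = begin
  sum (map f (oneTo m))                                           ≡⟨ cong (sum ∘ map f) oneTo-split ⟩
  sum (map f (interval 1 m′ ++ interval (suc m′) (m ∸ m′)))       ≡⟨ cong sum (map-++ f (interval 1 m′) _) ⟩
  sum (map f (interval 1 m′) ++ map f (interval (suc m′) (m ∸ m′))) ≡⟨ sum-++ (map f (interval 1 m′)) _ ⟩
  sum (map f (interval 1 m′)) + sum (map f (interval (suc m′) (m ∸ m′)))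
    ≡⟨ cong₂ _+_ (sum-map-cong (interval 1 m′) restricted) (sum-map-interval-0 f (suc m′) (m ∸ m′) beyond) ⟩
  sum (map f′ (interval 1 m′)) + 0                                ≡⟨ +-identityʳ _ ⟩
  sum (map f′ (interval 1 m′))                                    ≡⟨ cong (sum ∘ map f′) (oneTo≡interval m′) ⟨
  sum (map f′ (oneTo m′))                                         ∎
  where
  open ≡-Reasoning
  f f′ : ℕ → ℕ
  f  a = countTuples n m  (P ∘ (a ∷_))
  f′ a = countTuples n m′ (P ∘ (a ∷_))

  oneTo-split : oneTo m ≡ interval 1 m′ ++ interval (suc m′) (m ∸ m′)
  oneTo-split = trans (oneTo≡interval m)
    (trans (cong (interval 1) (sym (m+[n∸m]≡n m′≤m))) (interval-++ 1 m′ (m ∸ m′)))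

  restricted : ∀ a → f a ≡ f′ a
  restricted a = countTuples-restrict n m m′ (P ∘ (a ∷_)) m′≤m
    (λ α len Pα b b∈α → bounded (a ∷ α) (cong suc len) Pα b (member-∷ b a α b∈α))

  beyond : ∀ a → m′ < a → f a ≡ 0
  beyond a m′<a = countTuples-none n m (P ∘ (a ∷_)) excluded
    where
    excluded : ∀ t → length t ≡ n → P (a ∷ t) ≡ false
    excluded t len with P (a ∷ t) in Pat
    ... | false = refl
    ... | true  = ⊥-elim (<⇒≱ m′<a (bounded (a ∷ t) (cong suc len) Pat a (member-head a t)))

avoiding : ℕ → (List ℕ → Bool) → List ℕ → Bool
avoiding v Q β = not (member v β) ∧ Q β

withCopies : ℕ → ℕ → (List ℕ → Bool) → List ℕ → Bool
withCopies c v Q α = (count v α ≡ᵇ c) ∧ Q (remove v α)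

avoiding-∷-≢ : ∀ v Q a t → a ≢ v → avoiding v Q (a ∷ t) ≡ avoiding v (Q ∘ (a ∷_)) t
avoiding-∷-≢ v Q a t a≢v rewrite ≢⇒≡ᵇ-false v a (a≢v ∘ sym) = refl

withCopies-∷-self : ∀ c v Q t → withCopies (suc c) v Q (v ∷ t) ≡ withCopies c v Q t
withCopies-∷-self c v Q t rewrite ≡ᵇ-refl v = refl

withCopies-∷-≢ : ∀ c v Q a t → a ≢ v → withCopies c v Q (a ∷ t) ≡ withCopies c v (Q ∘ (a ∷_)) t
withCopies-∷-≢ c v Q a t a≢v rewrite ≢⇒≡ᵇ-false a v a≢v = refl

withCopies-tooShort : ∀ c v Q t → length t < c → withCopies c v Q t ≡ false
withCopies-tooShort c v Q t short with count v t ≡ᵇ c in e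
... | false = refl
... | true  = ⊥-elim (<⇒≱ short (subst (_≤ length t) (≡ᵇ-true⇒≡ _ _ e) (countBy≤length _ t)))

withCopies-0≡avoiding : ∀ v Q α → withCopies 0 v Q α ≡ avoiding v Q α
withCopies-0≡avoiding v Q α with count v α ≡ᵇ 0 | member≡not[count≡ᵇ0] v α
... | true  | v∉α rewrite v∉α | remove-¬member v α v∉α = refl
... | false | v∈α rewrite v∈α = refl

countTuples-avoiding-suc : ∀ n m v Q → countTuples (suc n) m (avoiding v Q) ≡
                           sumExcept v (λ a → countTuples n m (avoiding v (Q ∘ (a ∷_)))) (oneTo m)
countTuples-avoiding-suc n m v Q = sum-map-cong (oneTo m) pointwise
  where
  pointwise : ∀ a → countTuples n m (avoiding v Q ∘ (a ∷_)) ≡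
                    (if a ≡ᵇ v then 0 else countTuples n m (avoiding v (Q ∘ (a ∷_))))
  pointwise a with a ≡ᵇ v in a≡v
  ... | true rewrite ≡ᵇ-true⇒≡ a v a≡v =
    countTuples-none n m _ (λ t _ → cong (λ b → not b ∧ Q (v ∷ t)) (member-head v t))
  ... | false = countTuples-cong n m (λ t _ → avoiding-∷-≢ v Q a t (≡ᵇ-false⇒≢ a v a≡v))

-- The copies of v fill c of the c + n positions; splitting on the head of the tuple is Pascal's rule.
countTuples-withCopies : ∀ c n m v Q → count v (oneTo m) ≡ 1 →
  countTuples (c + n) m (withCopies c v Q) ≡ ((c + n) C c) * countTuples n m (avoiding v Q)

countTuples-withCopies-others : ∀ c n m v Q → count v (oneTo m) ≡ 1 →
  sumExcept v (λ a → countTuples (c + n) m (withCopies (suc c) v (Q ∘ (a ∷_)))) (oneTo m)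
    ≡ ((c + n) C suc c) * countTuples n m (avoiding v Q)

countTuples-withCopies zero    n m v Q _    =
  trans (countTuples-cong n m (λ α _ → withCopies-0≡avoiding v Q α)) (sym (*-identityˡ _))
countTuples-withCopies (suc c) n m v Q once = begin
  countTuples (suc c + n) m (withCopies (suc c) v Q)
    ≡⟨ sum-isolate v headed (oneTo m) once ⟩
  headed v + sumExcept v headed (oneTo m)
    ≡⟨ cong₂ _+_ (countTuples-cong (c + n) m (λ t _ → withCopies-∷-self c v Q t))
                 (sumExcept-cong v (oneTo m) (λ a a≢v →
                    countTuples-cong (c + n) m (λ t _ → withCopies-∷-≢ (suc c) v Q a t a≢v))) ⟩
  countTuples (c + n) m (withCopies c v Q) + sumExcept v others (oneTo m)
    ≡⟨ cong₂ _+_ (countTuples-withCopies c n m v Q once) (countTuples-withCopies-others c n m v Q once) ⟩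
  ((c + n) C c) * B + ((c + n) C suc c) * B
    ≡⟨ *-distribʳ-+ B ((c + n) C c) _ ⟨
  ((c + n) C c + (c + n) C suc c) * B
    ≡⟨ cong (_* B) (nCk+nC[k+1]≡[n+1]C[k+1] (c + n) c) ⟩
  ((suc c + n) C suc c) * B
    ∎
  where
  open ≡-Reasoning
  headed others : ℕ → ℕ
  headed a = countTuples (c + n) m (withCopies (suc c) v Q ∘ (a ∷_))
  others a = countTuples (c + n) m (withCopies (suc c) v (Q ∘ (a ∷_)))
  B = countTuples n m (avoiding v Q)

countTuples-withCopies-others c zero     m v Q _    rewrite k>n⇒nCk≡0 (s≤s (≤-reflexive (+-identityʳ c))) =
  sumExcept-0 v _ (oneTo m) (λ a _ → countTuples-none (c + 0) m _
    (λ t len → withCopies-tooShort (suc c) v (Q ∘ (a ∷_)) t (s≤s (≤-reflexive (trans len (+-identityʳ c))))))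
countTuples-withCopies-others c (suc n) m v Q once = begin
  sumExcept v (λ a → countTuples (c + suc n) m (withCopies (suc c) v (Q ∘ (a ∷_)))) (oneTo m)
    ≡⟨ sumExcept-cong v (oneTo m) (λ a _ →
         cong (λ l → countTuples l m (withCopies (suc c) v (Q ∘ (a ∷_)))) (+-suc c n)) ⟩
  sumExcept v (λ a → countTuples (suc c + n) m (withCopies (suc c) v (Q ∘ (a ∷_)))) (oneTo m)
    ≡⟨ sumExcept-cong v (oneTo m) (λ a _ → countTuples-withCopies (suc c) n m v (Q ∘ (a ∷_)) once) ⟩
  sumExcept v (λ a → ((suc c + n) C suc c) * countTuples n m (avoiding v (Q ∘ (a ∷_)))) (oneTo m)
    ≡⟨ sumExcept-* v ((suc c + n) C suc c) (λ a → countTuples n m (avoiding v (Q ∘ (a ∷_)))) (oneTo m) ⟩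
  ((suc c + n) C suc c) * sumExcept v (λ a → countTuples n m (avoiding v (Q ∘ (a ∷_)))) (oneTo m)
    ≡⟨ cong₂ (λ l s → (l C suc c) * s) (+-suc c n) (countTuples-avoiding-suc n m v Q) ⟨
  ((c + suc n) C suc c) * countTuples (suc n) m (avoiding v Q)
    ∎
  where open ≡-Reasoning


-- Removing the block of the largest value

unitFubiniWith : ℕ → List ℕ → Bool
unitFubiniWith k α = isUnitFubini α ∧ (distinct α ≡ᵇ k)

withCopies⇒unitFubiniWith : ∀ c v k α → 0 < c → c ≤ 2 → c + v ≡ suc (length α) →
                            withCopies c v (unitFubiniWith k) α ≡ true → unitFubiniWith (suc k) α ≡ true
withCopies⇒unitFubiniWith c v k α c>0 c≤2 c+v≡ copies = ∧-intro ufrα distinctα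
  where
  β = remove v α
  ufrWithβ : unitFubiniWith k β ≡ true
  ufrWithβ = ∧-conicalʳ (count v α ≡ᵇ c) _ copies
  ufrβ : isUnitFubini β ≡ true
  ufrβ = ∧-conicalˡ (isUnitFubini β) _ ufrWithβ
  count≡c : count v α ≡ c
  count≡c = ≡ᵇ-true⇒≡ _ _ (∧-conicalˡ (count v α ≡ᵇ c) _ copies)
  v∈α : member v α ≡ true
  v∈α = count>0⇒member v α (subst (0 <_) (sym count≡c) c>0)
  v≡ : v ≡ suc (length β)
  v≡ = +-cancelˡ-≡ c v (suc (length β)) (begin
    c + v                        ≡⟨ c+v≡ ⟩
    suc (length α)               ≡⟨ cong suc (count+length-remove v α) ⟨
    suc (count v α + length β)   ≡⟨ cong (λ x → suc (x + length β)) count≡c ⟩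
    suc (c + length β)           ≡⟨ +-suc c (length β) ⟨
    c + suc (length β)           ∎)
    where open ≡-Reasoning
  below : ∀ a → member a β ≡ true → a < v
  below a a∈β = subst (a <_) (sym v≡) (s≤s (unitFubini-value≤length β a ufrβ a∈β))
  ufrα : isUnitFubini α ≡ true
  ufrα = trans (unitFubini-remove-top v α v∈α below)
    (∧-intro ufrβ (∧-intro (trans (cong (v ≡ᵇ_) (sym v≡)) (≡ᵇ-refl v))
                           (≤⇒≤ᵇ-true _ 2 (subst (_≤ 2) (sym count≡c) c≤2))))
  distinctα : (distinct α ≡ᵇ suc k) ≡ true
  distinctα rewrite distinct-remove v α v∈α = ∧-conicalʳ (isUnitFubini β) _ ufrWithβ

unitFubiniWith⇒withCopies : ∀ N k α → length α ≡ suc N → unitFubiniWith (suc k) α ≡ true →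
  (withCopies 1 (suc N) (unitFubiniWith k) α ∨ withCopies 2 N (unitFubiniWith k) α) ≡ true
unitFubiniWith⇒withCopies N k α@(b ∷ α′) len ufrWith = byCount (count M α) refl
  where
  M = maximum α
  M∈α = maximum-member b α′
  β = remove M α

  below : ∀ a → member a β ≡ true → a < M
  below a a∈β with member-remove⇒ a M α a∈β
  ... | a≢M , a∈α = ≤∧≢⇒< (member⇒≤maximum a α a∈α) a≢M

  top : (isUnitFubini β ∧ ((M ≡ᵇ suc (length β)) ∧ (count M α ≤ᵇ 2))) ≡ true
  top = trans (sym (unitFubini-remove-top M α M∈α below)) (∧-conicalˡ (isUnitFubini α) _ ufrWith)

  M≡ : M ≡ suc (length β)
  M≡ = ≡ᵇ-true⇒≡ _ _ (∧-conicalˡ (M ≡ᵇ suc (length β)) _ (∧-conicalʳ (isUnitFubini β) _ top))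

  count≤2 : count M α ≤ 2
  count≤2 = ≤ᵇ-true⇒≤ _ 2 (∧-conicalʳ (M ≡ᵇ suc (length β)) _ (∧-conicalʳ (isUnitFubini β) _ top))

  ufrWithβ : unitFubiniWith k β ≡ true
  ufrWithβ = ∧-intro (∧-conicalˡ (isUnitFubini β) _ top)
    (subst (λ d → (d ≡ᵇ suc k) ≡ true) (distinct-remove M α M∈α) (∧-conicalʳ (isUnitFubini α) _ ufrWith))

  split : count M α + length β ≡ suc N
  split = trans (count+length-remove M α) len

  byCount : ∀ c → count M α ≡ c →
            (withCopies 1 (suc N) (unitFubiniWith k) α ∨ withCopies 2 N (unitFubiniWith k) α) ≡ true
  byCount zero c≡0 = ⊥-elim (<-irrefl (sym c≡0) (member⇒count>0 M α M∈α))
  byCount 1 c≡1 = ∨-introˡ (withCopies 2 N (unitFubiniWith k) α)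
    (subst (λ v → withCopies 1 v (unitFubiniWith k) α ≡ true) M≡1+N (∧-intro (cong (_≡ᵇ 1) c≡1) ufrWithβ))
    where
    M≡1+N : M ≡ suc N
    M≡1+N = trans M≡ (cong suc (suc-injective (trans (cong (_+ length β) (sym c≡1)) split)))
  byCount 2 c≡2 = ∨-introʳ (withCopies 1 (suc N) (unitFubiniWith k) α)
    (subst (λ v → withCopies 2 v (unitFubiniWith k) α ≡ true) M≡N (∧-intro (cong (_≡ᵇ 2) c≡2) ufrWithβ))
    where
    M≡N : M ≡ N
    M≡N = trans M≡ (suc-injective (trans (cong (_+ length β) (sym c≡2)) split))
  byCount (suc (suc (suc c))) c≡3+ = ⊥-elim (<⇒≱ (s≤s (s≤s (s≤s z≤n))) (subst (_≤ 2) c≡3+ count≤2))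

withCopies-disjoint : ∀ N k α → length α ≡ suc N →
  (withCopies 1 (suc N) (unitFubiniWith k) α ∧ withCopies 2 N (unitFubiniWith k) α) ≡ false
withCopies-disjoint N k α len with withCopies 1 (suc N) (unitFubiniWith k) α in once | count N α ≡ᵇ 2 in twice
... | false | _     = refl
... | true  | false = refl
... | true  | true  =
  ⊥-elim (true≢false (trans (sym 1+N∈α) (BlocksFit.gapAfterTie fit N (≡ᵇ-true⇒≡ _ _ twice))))
  where
  fit = unitFubini⇒BlocksFit α (∧-conicalˡ (isUnitFubini α) _
          (withCopies⇒unitFubiniWith 1 (suc N) k α (s≤s z≤n) (s≤s z≤n) (cong suc (sym len)) once))
  1+N∈α : member (suc N) α ≡ true
  1+N∈α = count>0⇒member (suc N) α
            (subst (0 <_) (sym (≡ᵇ-true⇒≡ _ _ (∧-conicalˡ (count (suc N) α ≡ᵇ 1) _ once))) (s≤s z≤n))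

unitFubiniWith-suc : ∀ N k α → length α ≡ suc N →
  unitFubiniWith (suc k) α ≡ (withCopies 1 (suc N) (unitFubiniWith k) α ∨ withCopies 2 N (unitFubiniWith k) α)
unitFubiniWith-suc N k α len = ⇔→≡ (mk⇔ (unitFubiniWith⇒withCopies N k α len) from)
  where
  from : (withCopies 1 (suc N) (unitFubiniWith k) α ∨ withCopies 2 N (unitFubiniWith k) α) ≡ true →
         unitFubiniWith (suc k) α ≡ true
  from copies with withCopies 1 (suc N) (unitFubiniWith k) α in once
  ... | true  = withCopies⇒unitFubiniWith 1 (suc N) k α (s≤s z≤n) (s≤s z≤n) (cong suc (sym len)) once
  ... | false = withCopies⇒unitFubiniWith 2 N k α (s≤s z≤n) ≤-refl (cong suc (sym len)) copies


-- The recurrence for f_UFR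

ufrCount : ℕ → ℕ → ℕ
ufrCount n k = countTuples n n (unitFubiniWith k)

fUFR≡ufrCount : ∀ n k → fUFR n k ≡ ufrCount n k
fUFR≡ufrCount n k = trans (length-filter-allTuples n n _) (countTuples-cong n n pointwise)
  where
  pointwise : ∀ α → length α ≡ n → (isUnitFubini α ∧ (luckyCars n α ≡ᵇ k)) ≡ unitFubiniWith k α
  pointwise α len with isUnitFubini α in ufr
  ... | true  = cong (_≡ᵇ k) (trans (cong (λ l → luckyCars l α) (sym len)) (luckyCars≡distinct α ufr))
  ... | false = refl

ufrCount-alphabet : ∀ n m k → n ≤ m → countTuples n m (unitFubiniWith k) ≡ ufrCount n k
ufrCount-alphabet n m k n≤m = countTuples-restrict n m n _ n≤m
  (λ α len ufrWith a a∈α →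
    subst (a ≤_) len (unitFubini-value≤length α a (∧-conicalˡ (isUnitFubini α) _ ufrWith) a∈α))

avoiding-beyondLength : ∀ v k β → length β < v → avoiding v (unitFubiniWith k) β ≡ unitFubiniWith k β
avoiding-beyondLength v k β short with unitFubiniWith k β in ufrWith
... | false = ∧-zeroʳ _
... | true with member v β in v∈β
...   | false = refl
...   | true  = ⊥-elim (<⇒≱ short (unitFubini-value≤length β v (∧-conicalˡ (isUnitFubini β) _ ufrWith) v∈β))

countTuples-withCopies-top : ∀ c n m k → suc n ≤ m →
  countTuples (c + n) m (withCopies c (suc n) (unitFubiniWith k)) ≡ ((c + n) C c) * ufrCount n k
countTuples-withCopies-top c n m k n<m = begin
  countTuples (c + n) m (withCopies c (suc n) (unitFubiniWith k))
    ≡⟨ countTuples-withCopies c n m (suc n) _ (count-oneTo (suc n) m (s≤s z≤n) n<m) ⟩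
  ((c + n) C c) * countTuples n m (avoiding (suc n) (unitFubiniWith k))
    ≡⟨ cong (((c + n) C c) *_)
         (countTuples-cong n m (λ β len → avoiding-beyondLength (suc n) k β (s≤s (≤-reflexive len)))) ⟩
  ((c + n) C c) * countTuples n m (unitFubiniWith k)
    ≡⟨ cong (((c + n) C c) *_) (ufrCount-alphabet n m k (<⇒≤ n<m)) ⟩
  ((c + n) C c) * ufrCount n k
    ∎
  where open ≡-Reasoning

ufrCount-suc : ∀ N k → ufrCount (suc N) (suc k) ≡
  countTuples (suc N) (suc N) (withCopies 1 (suc N) (unitFubiniWith k)) +
  countTuples (suc N) (suc N) (withCopies 2 N (unitFubiniWith k))
ufrCount-suc N k = trans (countTuples-cong (suc N) (suc N) (unitFubiniWith-suc N k))
                         (countTuples-∨ (suc N) (suc N) (withCopies 1 (suc N) (unitFubiniWith k))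
                                        (withCopies 2 N (unitFubiniWith k)) (withCopies-disjoint N k))

ufrCount-1+0 : ∀ N → ufrCount (suc N) 0 ≡ 0
ufrCount-1+0 N = countTuples-none (suc N) (suc N) _ nonempty
  where
  nonempty : ∀ α → length α ≡ suc N → unitFubiniWith 0 α ≡ false
  nonempty (a ∷ α) _ = ∧-zeroʳ _

ufrCount-1 : ∀ k → ufrCount 1 (suc k) ≡ ufrCount 0 k
ufrCount-1 k = begin
  ufrCount 1 (suc k)
    ≡⟨ ufrCount-suc 0 k ⟩
  countTuples 1 1 (withCopies 1 1 (unitFubiniWith k)) + countTuples 1 1 (withCopies 2 0 (unitFubiniWith k))
    ≡⟨ cong₂ _+_ (countTuples-withCopies-top 1 0 1 k ≤-refl)
                 (countTuples-none 1 1 _ (λ α len →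
                    withCopies-tooShort 2 0 (unitFubiniWith k) α (≤-reflexive (cong suc len)))) ⟩
  1 * ufrCount 0 k + 0
    ≡⟨ trans (+-identityʳ _) (*-identityˡ _) ⟩
  ufrCount 0 k
    ∎
  where open ≡-Reasoning

ufrCount-2+ : ∀ N k → ufrCount (2 + N) (suc k) ≡ (2 + N) * ufrCount (suc N) k + ((2 + N) C 2) * ufrCount N k
ufrCount-2+ N k = trans (ufrCount-suc (suc N) k) (cong₂ _+_
  (trans (countTuples-withCopies-top 1 (suc N) (2 + N) k ≤-refl) (cong (_* ufrCount (suc N) k) (nC1≡n (2 + N))))
  (countTuples-withCopies-top 2 N (2 + N) k (n≤1+n _)))

2*[2+n]C2 : ∀ n → 2 * ((2 + n) C 2) ≡ (2 + n) * (1 + n)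
2*[2+n]C2 zero    = refl
2*[2+n]C2 (suc n) = begin
  2 * ((3 + n) C 2)                       ≡⟨ cong (2 *_) (nCk+nC[k+1]≡[n+1]C[k+1] (2 + n) 1) ⟨
  2 * ((2 + n) C 1 + (2 + n) C 2)         ≡⟨ cong (λ c → 2 * (c + (2 + n) C 2)) (nC1≡n (2 + n)) ⟩
  2 * ((2 + n) + (2 + n) C 2)             ≡⟨ *-distribˡ-+ 2 (2 + n) _ ⟩
  2 * (2 + n) + 2 * ((2 + n) C 2)         ≡⟨ cong (λ c → 2 * (2 + n) + c) (2*[2+n]C2 n) ⟩
  2 * (2 + n) + (2 + n) * (1 + n)         ≡⟨ expand n ⟩
  (3 + n) * (2 + n)                       ∎
  where
  open ≡-Reasoning
  expand : ∀ n → 2 * (2 + n) + (2 + n) * (1 + n) ≡ (3 + n) * (2 + n)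
  expand = solve-∀


-- Formal power series

sumBelow : ℕ → (ℕ → ℚ) → ℚ
sumBelow zero    f = 0ℚ
sumBelow (suc c) f = f 0 ℚ.+ sumBelow c (f ∘ suc)

foldr-map-applyUpTo : ∀ c (g : ℕ → ℕ) (f : ℕ → ℚ) →
                      foldr ℚ._+_ 0ℚ (map f (applyUpTo g c)) ≡ sumBelow c (f ∘ g)
foldr-map-applyUpTo zero    g f = refl
foldr-map-applyUpTo (suc c) g f = cong (f (g 0) ℚ.+_) (foldr-map-applyUpTo c (g ∘ suc) f)

sumTo≡sumBelow : ∀ n f → sumTo n f ≡ sumBelow (suc n) f
sumTo≡sumBelow n f = foldr-map-applyUpTo (suc n) id f

sumBelow-cong : ∀ c {f g : ℕ → ℚ} → (∀ i → f i ≡ g i) → sumBelow c f ≡ sumBelow c g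
sumBelow-cong zero    _   = refl
sumBelow-cong (suc c) f≗g = cong₂ ℚ._+_ (f≗g 0) (sumBelow-cong c (f≗g ∘ suc))

sumBelow-0 : ∀ c (f : ℕ → ℚ) → (∀ i → f i ≡ 0ℚ) → sumBelow c f ≡ 0ℚ
sumBelow-0 zero    f _   = refl
sumBelow-0 (suc c) f f≗0 rewrite f≗0 0 | sumBelow-0 c (f ∘ suc) (f≗0 ∘ suc) = refl

sumBelow-+ : ∀ c (f g : ℕ → ℚ) → sumBelow c (λ i → f i ℚ.+ g i) ≡ sumBelow c f ℚ.+ sumBelow c g
sumBelow-+ zero    f g = refl
sumBelow-+ (suc c) f g rewrite sumBelow-+ c (f ∘ suc) (g ∘ suc) = interchange (f 0) (g 0) _ _
  where open CommSemigroupProperties (CommutativeMonoid.commutativeSemigroup ℚ.+-0-commutativeMonoid)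

sumBelow-neg : ∀ c (f : ℕ → ℚ) → sumBelow c (λ i → ℚ.- f i) ≡ ℚ.- sumBelow c f
sumBelow-neg zero    f = refl
sumBelow-neg (suc c) f rewrite sumBelow-neg c (f ∘ suc) = sym (ℚ.neg-distrib-+ (f 0) _)

sumBelow-* : ∀ c a (f : ℕ → ℚ) → sumBelow c (λ i → a ℚ.* f i) ≡ a ℚ.* sumBelow c f
sumBelow-* zero    a f = sym (ℚ.*-zeroʳ a)
sumBelow-* (suc c) a f rewrite sumBelow-* c a (f ∘ suc) = sym (ℚ.*-distribˡ-+ a (f 0) _)

sumBelow-pick-reversed : ∀ n p (H : ℕ → ℚ) →
  sumBelow (suc n) (λ i → if n ∸ i ≡ᵇ p then H i else 0ℚ) ≡ (if p ≤ᵇ n then H (n ∸ p) else 0ℚ)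
sumBelow-pick-reversed zero    zero    H = ℚ.+-identityʳ (H 0)
sumBelow-pick-reversed zero    (suc p) H = refl
sumBelow-pick-reversed (suc n) p       H
  rewrite sumBelow-pick-reversed n p (H ∘ suc) with <-cmp p (suc n)
... | tri< p<1+n _ _
  rewrite ≢⇒≡ᵇ-false (suc n) p (λ e → <⇒≢ p<1+n (sym e)) | ≤⇒≤ᵇ-true p n (≤-pred p<1+n)
        | ≤⇒≤ᵇ-true p (suc n) (<⇒≤ p<1+n) =
  trans (ℚ.+-identityˡ _) (cong H (sym (+-∸-assoc 1 (≤-pred p<1+n))))
... | tri≈ _ refl _
  rewrite ≡ᵇ-refl n | >⇒≤ᵇ-false (suc n) n (n<1+n n) | ≤⇒≤ᵇ-true (suc n) (suc n) ≤-refl | n∸n≡0 n =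
  ℚ.+-identityʳ (H 0)
... | tri> _ _ 1+n<p
  rewrite ≢⇒≡ᵇ-false (suc n) p (<⇒≢ 1+n<p) | >⇒≤ᵇ-false p n (<-trans (n<1+n n) 1+n<p)
        | >⇒≤ᵇ-false p (suc n) 1+n<p = refl

sumBelow-pick : ∀ c p (H : ℕ → ℚ) →
                sumBelow c (λ i → if i ≡ᵇ p then H i else 0ℚ) ≡ (if p <ᵇ c then H p else 0ℚ)
sumBelow-pick zero    p       H = refl
sumBelow-pick (suc c) zero    H = trans (cong (H 0 ℚ.+_) (sumBelow-0 c _ (λ _ → refl))) (ℚ.+-identityʳ (H 0))
sumBelow-pick (suc c) (suc p) H = trans (ℚ.+-identityˡ _) (sumBelow-pick c p (H ∘ suc))

infix 4 _≈ₛ_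
_≈ₛ_ : Series → Series → Set
F ≈ₛ G = ∀ n k → F n k ≡ G n k

monomial : ℕ → ℕ → Series
monomial p r n k = if n ≡ᵇ p then (if k ≡ᵇ r then 1ℚ else 0ℚ) else 0ℚ

shift : ℕ → ℕ → Series → Series
shift p r F n k = if p ≤ᵇ n then (if r ≤ᵇ k then F (n ∸ p) (k ∸ r) else 0ℚ) else 0ℚ

sumBelow² : ℕ → ℕ → (ℕ → ℕ → ℚ) → ℚ
sumBelow² n k f = sumBelow (suc n) (λ i → sumBelow (suc k) (f i))

⊛≡sumBelow² : ∀ F G n k → (F ⊛ G) n k ≡ sumBelow² n k (λ i j → F i j ℚ.* G (n ∸ i) (k ∸ j))
⊛≡sumBelow² F G n k =
  trans (sumTo≡sumBelow n (λ i → sumTo k (FG i))) (sumBelow-cong (suc n) (λ i → sumTo≡sumBelow k (FG i)))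
  where
  FG : ℕ → ℕ → ℚ
  FG i j = F i j ℚ.* G (n ∸ i) (k ∸ j)

sumBelow²-cong : ∀ n k {f g : ℕ → ℕ → ℚ} → (∀ i j → f i j ≡ g i j) →
                 sumBelow² n k f ≡ sumBelow² n k g
sumBelow²-cong n k f≗g = sumBelow-cong (suc n) (λ i → sumBelow-cong (suc k) (f≗g i))

sumBelow²-+ : ∀ n k f g → sumBelow² n k (λ i j → f i j ℚ.+ g i j) ≡ sumBelow² n k f ℚ.+ sumBelow² n k g
sumBelow²-+ n k f g = trans (sumBelow-cong (suc n) (λ i → sumBelow-+ (suc k) (f i) (g i)))
                             (sumBelow-+ (suc n) (λ i → sumBelow (suc k) (f i)) (λ i → sumBelow (suc k) (g i)))

sumBelow²-neg : ∀ n k f → sumBelow² n k (λ i j → ℚ.- f i j) ≡ ℚ.- sumBelow² n k f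
sumBelow²-neg n k f = trans (sumBelow-cong (suc n) (λ i → sumBelow-neg (suc k) (f i)))
                             (sumBelow-neg (suc n) (λ i → sumBelow (suc k) (f i)))

sumBelow²-* : ∀ n k a f → sumBelow² n k (λ i j → a ℚ.* f i j) ≡ a ℚ.* sumBelow² n k f
sumBelow²-* n k a f = trans (sumBelow-cong (suc n) (λ i → sumBelow-* (suc k) a (f i)))
                             (sumBelow-* (suc n) a (λ i → sumBelow (suc k) (f i)))

⊛-cong : ∀ F F′ G G′ → F ≈ₛ F′ → G ≈ₛ G′ → F ⊛ G ≈ₛ F′ ⊛ G′
⊛-cong F F′ G G′ F≈F′ G≈G′ n k = begin
  (F ⊛ G) n k                                                ≡⟨ ⊛≡sumBelow² F G n k ⟩
  sumBelow² n k (λ i j → F i j ℚ.* G (n ∸ i) (k ∸ j))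
    ≡⟨ sumBelow²-cong n k (λ i j → cong₂ ℚ._*_ (F≈F′ i j) (G≈G′ (n ∸ i) (k ∸ j))) ⟩
  sumBelow² n k (λ i j → F′ i j ℚ.* G′ (n ∸ i) (k ∸ j))      ≡⟨ ⊛≡sumBelow² F′ G′ n k ⟨
  (F′ ⊛ G′) n k                                              ∎
  where open ≡-Reasoning

⊛-congˡ : ∀ {F F′} G → F ≈ₛ F′ → F ⊛ G ≈ₛ F′ ⊛ G
⊛-congˡ {F} {F′} G F≈F′ = ⊛-cong F F′ G G F≈F′ (λ _ _ → refl)

⊛-congʳ : ∀ F {G G′} → G ≈ₛ G′ → F ⊛ G ≈ₛ F ⊛ G′
⊛-congʳ F {G} {G′} G≈G′ = ⊛-cong F F G G′ (λ _ _ → refl) G≈G′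

⊛-distribˡ-⊕ : ∀ F G H → F ⊛ (G ⊕ H) ≈ₛ (F ⊛ G) ⊕ (F ⊛ H)
⊛-distribˡ-⊕ F G H n k = begin
  (F ⊛ (G ⊕ H)) n k
    ≡⟨ ⊛≡sumBelow² F (G ⊕ H) n k ⟩
  sumBelow² n k (λ i j → F i j ℚ.* (G (n ∸ i) (k ∸ j) ℚ.+ H (n ∸ i) (k ∸ j)))
    ≡⟨ sumBelow²-cong n k (λ i j → ℚ.*-distribˡ-+ (F i j) (G (n ∸ i) (k ∸ j)) (H (n ∸ i) (k ∸ j))) ⟩
  sumBelow² n k (λ i j → FG i j ℚ.+ FH i j)
    ≡⟨ sumBelow²-+ n k FG FH ⟩
  sumBelow² n k FG ℚ.+ sumBelow² n k FH
    ≡⟨ cong₂ ℚ._+_ (⊛≡sumBelow² F G n k) (⊛≡sumBelow² F H n k) ⟨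
  (F ⊛ G) n k ℚ.+ (F ⊛ H) n k
    ∎
  where
  open ≡-Reasoning
  FG FH : ℕ → ℕ → ℚ
  FG i j = F i j ℚ.* G (n ∸ i) (k ∸ j)
  FH i j = F i j ℚ.* H (n ∸ i) (k ∸ j)

⊛-distribˡ-⊖ : ∀ F G H → F ⊛ (G ⊖ H) ≈ₛ (F ⊛ G) ⊖ (F ⊛ H)
⊛-distribˡ-⊖ F G H n k = begin
  (F ⊛ (G ⊖ H)) n k
    ≡⟨ ⊛≡sumBelow² F (G ⊖ H) n k ⟩
  sumBelow² n k (λ i j → F i j ℚ.* (G (n ∸ i) (k ∸ j) ℚ.- H (n ∸ i) (k ∸ j)))
    ≡⟨ sumBelow²-cong n k (λ i j →
         trans (ℚ.*-distribˡ-+ (F i j) (G (n ∸ i) (k ∸ j)) (ℚ.- H (n ∸ i) (k ∸ j)))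
               (cong (FG i j ℚ.+_) (sym (ℚ.neg-distribʳ-* (F i j) (H (n ∸ i) (k ∸ j)))))) ⟩
  sumBelow² n k (λ i j → FG i j ℚ.+ ℚ.- FH i j)
    ≡⟨ sumBelow²-+ n k FG (λ i j → ℚ.- FH i j) ⟩
  sumBelow² n k FG ℚ.+ sumBelow² n k (λ i j → ℚ.- FH i j)
    ≡⟨ cong (sumBelow² n k FG ℚ.+_) (sumBelow²-neg n k FH) ⟩
  sumBelow² n k FG ℚ.- sumBelow² n k FH
    ≡⟨ cong₂ ℚ._-_ (⊛≡sumBelow² F G n k) (⊛≡sumBelow² F H n k) ⟨
  (F ⊛ G) n k ℚ.- (F ⊛ H) n k
    ∎
  where
  open ≡-Reasoning
  FG FH : ℕ → ℕ → ℚ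
  FG i j = F i j ℚ.* G (n ∸ i) (k ∸ j)
  FH i j = F i j ℚ.* H (n ∸ i) (k ∸ j)

⊛-·ₛ : ∀ F a G → F ⊛ (a ·ₛ G) ≈ₛ a ·ₛ (F ⊛ G)
⊛-·ₛ F a G n k = begin
  (F ⊛ (a ·ₛ G)) n k
    ≡⟨ ⊛≡sumBelow² F (a ·ₛ G) n k ⟩
  sumBelow² n k (λ i j → F i j ℚ.* (a ℚ.* G (n ∸ i) (k ∸ j)))
    ≡⟨ sumBelow²-cong n k (λ i j → x∙yz≈y∙xz (F i j) a (G (n ∸ i) (k ∸ j))) ⟩
  sumBelow² n k (λ i j → a ℚ.* FG i j)
    ≡⟨ sumBelow²-* n k a FG ⟩
  a ℚ.* sumBelow² n k FG
    ≡⟨ cong (a ℚ.*_) (⊛≡sumBelow² F G n k) ⟨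
  a ℚ.* (F ⊛ G) n k
    ∎
  where
  open ≡-Reasoning
  FG : ℕ → ℕ → ℚ
  FG i j = F i j ℚ.* G (n ∸ i) (k ∸ j)
  open CommSemigroupProperties (CommutativeMonoid.commutativeSemigroup ℚ.*-1-commutativeMonoid)

*-indicator : ∀ x b → x ℚ.* (if b then 1ℚ else 0ℚ) ≡ (if b then x else 0ℚ)
*-indicator x true  = ℚ.*-identityʳ x
*-indicator x false = ℚ.*-zeroʳ x

indicator-* : ∀ x b → (if b then 1ℚ else 0ℚ) ℚ.* x ≡ (if b then x else 0ℚ)
indicator-* x true  = ℚ.*-identityˡ x
indicator-* x false = ℚ.*-zeroˡ x

⊛-monomial : ∀ F p r → F ⊛ monomial p r ≈ₛ shift p r F
⊛-monomial F p r n k = begin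
  (F ⊛ monomial p r) n k
    ≡⟨ ⊛≡sumBelow² F (monomial p r) n k ⟩
  sumBelow (suc n) (λ i → sumBelow (suc k) (λ j → F i j ℚ.* monomial p r (n ∸ i) (k ∸ j)))
    ≡⟨ sumBelow-cong (suc n) column ⟩
  sumBelow (suc n) (λ i → if n ∸ i ≡ᵇ p then H i else 0ℚ)
    ≡⟨ sumBelow-pick-reversed n p H ⟩
  shift p r F n k
    ∎
  where
  open ≡-Reasoning
  H : ℕ → ℚ
  H i = if r ≤ᵇ k then F i (k ∸ r) else 0ℚ
  column : ∀ i → sumBelow (suc k) (λ j → F i j ℚ.* monomial p r (n ∸ i) (k ∸ j)) ≡
                 (if n ∸ i ≡ᵇ p then H i else 0ℚ)
  column i with n ∸ i ≡ᵇ p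
  ... | true  = trans (sumBelow-cong (suc k) (λ j → *-indicator (F i j) (k ∸ j ≡ᵇ r)))
                      (sumBelow-pick-reversed k r (F i))
  ... | false = sumBelow-0 (suc k) _ (λ j → ℚ.*-zeroʳ (F i j))

monomial-⊛ : ∀ p r F → monomial p r ⊛ F ≈ₛ shift p r F
monomial-⊛ p r F n k = begin
  (monomial p r ⊛ F) n k
    ≡⟨ ⊛≡sumBelow² (monomial p r) F n k ⟩
  sumBelow (suc n) (λ i → sumBelow (suc k) (λ j → monomial p r i j ℚ.* F (n ∸ i) (k ∸ j)))
    ≡⟨ sumBelow-cong (suc n) column ⟩
  sumBelow (suc n) (λ i → if i ≡ᵇ p then H i else 0ℚ)
    ≡⟨ sumBelow-pick (suc n) p H ⟩
  (if p <ᵇ suc n then H p else 0ℚ)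
    ≡⟨ cong₂ (λ b c → if b then (if c then F (n ∸ p) (k ∸ r) else 0ℚ) else 0ℚ)
             (<ᵇ-suc≡≤ᵇ p n) (<ᵇ-suc≡≤ᵇ r k) ⟩
  shift p r F n k
    ∎
  where
  open ≡-Reasoning
  H : ℕ → ℚ
  H i = if r <ᵇ suc k then F (n ∸ i) (k ∸ r) else 0ℚ
  column : ∀ i → sumBelow (suc k) (λ j → monomial p r i j ℚ.* F (n ∸ i) (k ∸ j)) ≡
                 (if i ≡ᵇ p then H i else 0ℚ)
  column i with i ≡ᵇ p
  ... | true  = trans (sumBelow-cong (suc k) (λ j → indicator-* (F (n ∸ i) (k ∸ j)) (j ≡ᵇ r)))
                      (sumBelow-pick (suc k) r (λ j → F (n ∸ i) (k ∸ j)))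
  ... | false = sumBelow-0 (suc k) _ (λ j → ℚ.*-zeroˡ (F (n ∸ i) (k ∸ j)))

shift-cong : ∀ p r {F G} → F ≈ₛ G → shift p r F ≈ₛ shift p r G
shift-cong p r F≈G n k =
  cong (λ x → if p ≤ᵇ n then (if r ≤ᵇ k then x else 0ℚ) else 0ℚ) (F≈G (n ∸ p) (k ∸ r))

oneS≈monomial : oneS ≈ₛ monomial 0 0
oneS≈monomial zero    zero    = refl
oneS≈monomial zero    (suc k) = refl
oneS≈monomial (suc n) k       = refl

xS≈monomial : xS ≈ₛ monomial 1 0
xS≈monomial zero          zero    = refl
xS≈monomial zero          (suc k) = refl
xS≈monomial (suc zero)    zero    = refl
xS≈monomial (suc zero)    (suc k) = refl
xS≈monomial (suc (suc n)) zero    = refl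
xS≈monomial (suc (suc n)) (suc k) = refl

qS≈monomial : qS ≈ₛ monomial 0 1
qS≈monomial zero    zero          = refl
qS≈monomial zero    (suc zero)    = refl
qS≈monomial zero    (suc (suc k)) = refl
qS≈monomial (suc n) zero          = refl
qS≈monomial (suc n) (suc zero)    = refl
qS≈monomial (suc n) (suc (suc k)) = refl

q[x+½x²]≈ : qS ⊛ (xS ⊕ (½ ·ₛ (xS ⊛ xS))) ≈ₛ monomial 1 1 ⊕ (½ ·ₛ monomial 2 1)
q[x+½x²]≈ n k = begin
  (qS ⊛ (xS ⊕ (½ ·ₛ (xS ⊛ xS)))) n k
    ≡⟨ ⊛-congˡ (xS ⊕ (½ ·ₛ (xS ⊛ xS))) qS≈monomial n k ⟩
  (monomial 0 1 ⊛ (xS ⊕ (½ ·ₛ (xS ⊛ xS)))) n k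
    ≡⟨ monomial-⊛ 0 1 (xS ⊕ (½ ·ₛ (xS ⊛ xS))) n k ⟩
  shift 0 1 (xS ⊕ (½ ·ₛ (xS ⊛ xS))) n k
    ≡⟨ shift-cong 0 1 (λ n′ k′ → cong (λ y → xS n′ k′ ℚ.+ ½ ℚ.* y) (x²≈ n′ k′)) n k ⟩
  shift 0 1 (xS ⊕ (½ ·ₛ shift 1 0 xS)) n k
    ≡⟨ byCases n k ⟩
  (monomial 1 1 ⊕ (½ ·ₛ monomial 2 1)) n k
    ∎
  where
  open ≡-Reasoning
  x²≈ : xS ⊛ xS ≈ₛ shift 1 0 xS
  x²≈ n k = trans (⊛-congˡ xS xS≈monomial n k) (monomial-⊛ 1 0 xS n k)
  byCases : shift 0 1 (xS ⊕ (½ ·ₛ shift 1 0 xS)) ≈ₛ monomial 1 1 ⊕ (½ ·ₛ monomial 2 1)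
  byCases zero                zero          = refl
  byCases zero                (suc zero)    = refl
  byCases zero                (suc (suc k)) = refl
  byCases (suc zero)          zero          = refl
  byCases (suc zero)          (suc zero)    = refl
  byCases (suc zero)          (suc (suc k)) = refl
  byCases (suc (suc zero))    zero          = refl
  byCases (suc (suc zero))    (suc zero)    = refl
  byCases (suc (suc zero))    (suc (suc k)) = refl
  byCases (suc (suc (suc n))) zero          = refl
  byCases (suc (suc (suc n))) (suc zero)    = refl
  byCases (suc (suc (suc n))) (suc (suc k)) = refl

⊛-denominator : ∀ F → F ⊛ denominator ≈ₛ F ⊖ (shift 1 1 F ⊕ (½ ·ₛ shift 2 1 F))
⊛-denominator F n k = begin
  (F ⊛ denominator) n k
    ≡⟨ ⊛-distribˡ-⊖ F oneS tail n k ⟩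
  (F ⊛ oneS) n k ℚ.- (F ⊛ tail) n k
    ≡⟨ cong₂ ℚ._-_ (trans (⊛-congʳ F oneS≈monomial n k) (⊛-monomial F 0 0 n k))
                   (⊛-congʳ F q[x+½x²]≈ n k) ⟩
  F n k ℚ.- (F ⊛ (monomial 1 1 ⊕ (½ ·ₛ monomial 2 1))) n k
    ≡⟨ cong (λ y → F n k ℚ.- y) (⊛-distribˡ-⊕ F (monomial 1 1) (½ ·ₛ monomial 2 1) n k) ⟩
  F n k ℚ.- ((F ⊛ monomial 1 1) n k ℚ.+ (F ⊛ (½ ·ₛ monomial 2 1)) n k)
    ≡⟨ cong (λ y → F n k ℚ.- ((F ⊛ monomial 1 1) n k ℚ.+ y)) (⊛-·ₛ F ½ (monomial 2 1) n k) ⟩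
  F n k ℚ.- ((F ⊛ monomial 1 1) n k ℚ.+ ½ ℚ.* (F ⊛ monomial 2 1) n k)
    ≡⟨ cong₂ (λ y z → F n k ℚ.- (y ℚ.+ ½ ℚ.* z)) (⊛-monomial F 1 1 n k) (⊛-monomial F 2 1 n k) ⟩
  F n k ℚ.- (shift 1 1 F n k ℚ.+ ½ ℚ.* shift 2 1 F n k)
    ∎
  where
  open ≡-Reasoning
  tail = qS ⊛ (xS ⊕ (½ ·ₛ (xS ⊛ xS)))

⊛-denominator≈oneS : ∀ F → F 0 0 ≡ 1ℚ → (∀ k → F 0 (suc k) ≡ 0ℚ) → (∀ N → F (suc N) 0 ≡ 0ℚ) →
                     (∀ k → F 1 (suc k) ≡ F 0 k) →
                     (∀ N k → F (2 + N) (suc k) ≡ F (suc N) k ℚ.+ ½ ℚ.* F N k) →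
                     F ⊛ denominator ≈ₛ oneS
⊛-denominator≈oneS F F00 F0s Fs0 F1s F2s n k = trans (⊛-denominator F n k) (coefficient n k)
  where
  coefficient : ∀ n k → F n k ℚ.- (shift 1 1 F n k ℚ.+ ½ ℚ.* shift 2 1 F n k) ≡ oneS n k
  coefficient zero          zero    rewrite F00 = refl
  coefficient zero          (suc k) rewrite F0s k = refl
  coefficient (suc zero)    zero    rewrite Fs0 0 = refl
  coefficient (suc (suc N)) zero    rewrite Fs0 (suc N) = refl
  coefficient (suc zero)    (suc k) rewrite F1s k =
    trans (cong (λ y → F 0 k ℚ.- y) (ℚ.+-identityʳ (F 0 k))) (ℚ.+-inverseʳ (F 0 k))
  coefficient (suc (suc N)) (suc k) rewrite F2s N k = ℚ.+-inverseʳ (F (suc N) k ℚ.+ ½ ℚ.* F N k)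


-- The exponential generating function

-- Opened only here: elsewhere ℤ's +_ would make sections of ℕ's _+_ ambiguous.
module _ where
  open import Data.Integer using (+_)

  a*d≡c*b⇒a/b≡c/d : ∀ a b c d .{{_ : NonZero b}} .{{_ : NonZero d}} →
                    a * d ≡ c * b → (+ a) ℚ./ b ≡ (+ c) ℚ./ d
  a*d≡c*b⇒a/b≡c/d a (suc b) c (suc d) eq = ℚ.fromℚᵘ-cong {mkℚᵘ (+ a) b} {mkℚᵘ (+ c) d}
    (*≡* (trans (sym (ℤ.pos-* a (suc d))) (trans (cong +_ eq) (ℤ.pos-* c (suc b)))))

  a/d+c/d≡[a+c]/d : ∀ a c d .{{_ : NonZero d}} → (+ a) ℚ./ d ℚ.+ (+ c) ℚ./ d ≡ (+ (a + c)) ℚ./ d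
  a/d+c/d≡[a+c]/d a c d@(suc d-1) = ℚ.toℚᵘ-injective (begin
    ℚ.toℚᵘ ((+ a) ℚ./ d ℚ.+ (+ c) ℚ./ d)           ≈⟨ ℚ.toℚᵘ-homo-+ ((+ a) ℚ./ d) ((+ c) ℚ./ d) ⟩
    ℚ.toℚᵘ ((+ a) ℚ./ d) ℚᵘ.+ ℚ.toℚᵘ ((+ c) ℚ./ d)
      ≈⟨ ℚᵘ.+-cong (ℚ.toℚᵘ-fromℚᵘ (mkℚᵘ (+ a) d-1)) (ℚ.toℚᵘ-fromℚᵘ (mkℚᵘ (+ c) d-1)) ⟩
    mkℚᵘ (+ a) d-1 ℚᵘ.+ mkℚᵘ (+ c) d-1         ≈⟨ *≡* cross ⟩
    mkℚᵘ (+ (a + c)) d-1                       ≈⟨ ℚ.toℚᵘ-fromℚᵘ (mkℚᵘ (+ (a + c)) d-1) ⟨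
    ℚ.toℚᵘ ((+ (a + c)) ℚ./ d)                   ∎)
    where
    open ℚᵘ.≃-Reasoning
    cross : (+ a ℤ.* + d ℤ.+ + c ℤ.* + d) ℤ.* + d ≡ + (a + c) ℤ.* + (d * d)
    cross = trans (distrib (+ a) (+ c) (+ d)) (sym (cong₂ ℤ._*_ (ℤ.pos-+ a c) (ℤ.pos-* d d)))
      where
      distrib : ∀ A C D → (A ℤ.* D ℤ.+ C ℤ.* D) ℤ.* D ≡ (A ℤ.+ C) ℤ.* (D ℤ.* D)
      distrib = ℤ-Solver.solve-∀

  ½*b/d≡b/[2*d] : ∀ b d .{{_ : NonZero d}} → ½ ℚ.* ((+ b) ℚ./ d) ≡ ((+ b) ℚ./ (2 * d)) {{m*n≢0 2 d}}
  ½*b/d≡b/[2*d] b d@(suc d-1) = ℚ.toℚᵘ-injective (begin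
    ℚ.toℚᵘ (½ ℚ.* ((+ b) ℚ./ d))                ≈⟨ ℚ.toℚᵘ-homo-* ½ ((+ b) ℚ./ d) ⟩
    ℚ.toℚᵘ ½ ℚᵘ.* ℚ.toℚᵘ ((+ b) ℚ./ d)
      ≈⟨ ℚᵘ.*-congˡ {ℚ.toℚᵘ ½} (ℚ.toℚᵘ-fromℚᵘ (mkℚᵘ (+ b) d-1)) ⟩
    ℚ.toℚᵘ ½ ℚᵘ.* mkℚᵘ (+ b) d-1
      ≈⟨ *≡* (cong (ℤ._* + (2 * d)) (ℤ.*-identityˡ (+ b))) ⟩
    mkℚᵘ (+ b) (ℕ.pred (2 * d))               ≈⟨ ℚ.toℚᵘ-fromℚᵘ (mkℚᵘ (+ b) (ℕ.pred (2 * d))) ⟨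
    ℚ.toℚᵘ (((+ b) ℚ./ (2 * d)) {{m*n≢0 2 d}})  ∎)
    where open ℚᵘ.≃-Reasoning

  ufrEGF≡ufrCount/n! : ∀ n k → ufrEGF n k ≡ ((+ ufrCount n k) ℚ./ n !) {{n !≢0}}
  ufrEGF≡ufrCount/n! n k = cong (λ c → ((+ c) ℚ./ n !) {{n !≢0}}) (fUFR≡ufrCount n k)

  ufrEGF-1+0 : ∀ N → ufrEGF (suc N) 0 ≡ 0ℚ
  ufrEGF-1+0 N = trans (ufrEGF≡ufrCount/n! (suc N) 0)
    (trans (cong (λ c → ((+ c) ℚ./ suc N !) {{suc N !≢0}}) (ufrCount-1+0 N)) (ℚ.0/n≡0 (suc N !) {{suc N !≢0}}))

  ufrEGF-1 : ∀ k → ufrEGF 1 (suc k) ≡ ufrEGF 0 k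
  ufrEGF-1 k = trans (ufrEGF≡ufrCount/n! 1 (suc k))
    (trans (cong (λ c → (+ c) ℚ./ 1) (ufrCount-1 k)) (sym (ufrEGF≡ufrCount/n! 0 k)))

  ufrEGF-2+ : ∀ N k → ufrEGF (2 + N) (suc k) ≡ ufrEGF (suc N) k ℚ.+ ½ ℚ.* ufrEGF N k
  ufrEGF-2+ N k = begin
    ufrEGF (2 + N) (suc k)
      ≡⟨ ufrEGF≡ufrCount/n! (2 + N) (suc k) ⟩
    (+ ufrCount (2 + N) (suc k)) ℚ./ (2 + N) !
      ≡⟨ cong (λ c → (+ c) ℚ./ (2 + N) !) (ufrCount-2+ N k) ⟩
    (+ ((2 + N) * a + C₂ * b)) ℚ./ (2 + N) !
      ≡⟨ a/d+c/d≡[a+c]/d ((2 + N) * a) (C₂ * b) ((2 + N) !) ⟨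
    (+ ((2 + N) * a)) ℚ./ (2 + N) ! ℚ.+ (+ (C₂ * b)) ℚ./ (2 + N) !
      ≡⟨ cong₂ ℚ._+_ (a*d≡c*b⇒a/b≡c/d a ((1 + N) !) ((2 + N) * a) ((2 + N) !) first)
                     (a*d≡c*b⇒a/b≡c/d b (2 * N !) (C₂ * b) ((2 + N) !) second) ⟨
    (+ a) ℚ./ (1 + N) ! ℚ.+ (+ b) ℚ./ (2 * N !)
      ≡⟨ cong (λ x → (+ a) ℚ./ (1 + N) ! ℚ.+ x) (½*b/d≡b/[2*d] b (N !)) ⟨
    (+ a) ℚ./ (1 + N) ! ℚ.+ ½ ℚ.* ((+ b) ℚ./ N !)
      ≡⟨ cong₂ (λ x y → x ℚ.+ ½ ℚ.* y) (ufrEGF≡ufrCount/n! (suc N) k) (ufrEGF≡ufrCount/n! N k) ⟨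
    ufrEGF (suc N) k ℚ.+ ½ ℚ.* ufrEGF N k
      ∎
    where
    open ≡-Reasoning
    instance
      _ = N !≢0
      _ = (1 + N) !≢0
      _ = (2 + N) !≢0
      _ = m*n≢0 2 (N !)
    a = ufrCount (suc N) k
    b = ufrCount N k
    C₂ = (2 + N) C 2

    first : a * (2 + N) ! ≡ ((2 + N) * a) * (1 + N) !
    first = x∙yz≈yx∙z a (2 + N) ((1 + N) !)
      where open CommSemigroupProperties *-commutativeSemigroup

    second : b * (2 + N) ! ≡ (C₂ * b) * (2 * N !)
    second = begin
      b * ((2 + N) * ((1 + N) * N !))    ≡⟨ cong (b *_) (*-assoc (2 + N) (1 + N) (N !)) ⟨
      b * ((2 + N) * (1 + N) * N !)      ≡⟨ cong (λ c → b * (c * N !)) (2*[2+n]C2 N) ⟨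
      b * (2 * C₂ * N !)                  ≡⟨ rearrange b C₂ (N !) ⟩
      (C₂ * b) * (2 * N !)                ∎
      where
      rearrange : ∀ b c f → b * (2 * c * f) ≡ (c * b) * (2 * f)
      rearrange = solve-∀

theorem3p10 : (n k : ℕ) → (ufrEGF ⊛ denominator) n k ≡ oneS n k
theorem3p10 = ⊛-denominator≈oneS ufrEGF refl (λ _ → refl) ufrEGF-1+0 ufrEGF-1 ufrEGF-2+
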